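{- Let $m,d,k$ be integers with $m\geq 3$ and $0\leq d\leq m$, and let $F$ be the frequency array of order $k$ defined by $F(i,j)=1$ if ($i\leq m$ or $j\leq m$) and $i\neq j$; $F(i,j)=d$ if $(i,j)\in\{(m+1,m+2),(m+2,m+1)\}$; and $F(i,j)=0$ otherwise. If $m+2\leq k\leq 2m-1$, then there exists an outline array corresponding to $F$. Moreover, if $m\geq 4$ and $d\geq\frac{m}{2}$, then there also exists an outline array corresponding to $F$ when $k=2m$.
   Context: A frequency array $F$ of order $k$ is a $k\times k$ array each of whose cells contains a single non-negative integer. Given a $k\times k$ array $O$ of multisets with elements from $[k]$, let $O(i,j)$ be the multiset in cell $(i,j)$, $O^i_\ell$ the number of copies of symbol $\ell$ in row $i$, and ${}^jO_\ell$ the number of copies of symbol $\ell$ in column $j$ (counted with multiplicity). $O$ is an outline array corresponding to $F$ if for all $i,j,\ell\in[k]$: $|O(i,j)|=F(i,j)$, $O^i_\ell=F(i,\ell)$, and ${}^jO_\ell=F(\ell,j)$. -}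

module Defs where

open import Data.Nat using (ℕ; zero; suc; _+_; _<_; _≤_)
open import Data.Fin using (Fin; toℕ)
open import Data.Fin as F using ()
open import Data.Sum using (_⊎_)
open import Data.Product using (_×_; Σ)
open import Relation.Nullary using (¬_; Dec; yes; no)
open import Relation.Nullary.Decidable using (_⊎-dec_; _×-dec_)
open import Relation.Binary.PropositionalEquality using (_≡_)
open import Data.Nat.Properties using (_<?_; _≟_)

∑ : {n : ℕ} → (Fin n → ℕ) → ℕ
∑ {zero} f = 0
∑ {suc n} f = f F.zero + ∑ (λ i → f (F.suc i))

-- A frequency array of order k: k × k array of naturals.
-- Cells/symbols are indexed by Fin k; Fin index i corresponds to the
-- paper's 1-based index (toℕ i + 1).
FreqArray : ℕ → Set
FreqArray k = Fin k → Fin k → ℕ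

Multiset : ℕ → Set
Multiset k = Fin k → ℕ

∣_∣ₘ : {k : ℕ} → Multiset k → ℕ
∣ M ∣ₘ = ∑ M

MultisetArray : ℕ → Set
MultisetArray k = Fin k → Fin k → Multiset k

rowCount : {k : ℕ} → MultisetArray k → Fin k → Fin k → ℕ
rowCount O i ℓ = ∑ (λ j → O i j ℓ)

colCount : {k : ℕ} → MultisetArray k → Fin k → Fin k → ℕ
colCount O j ℓ = ∑ (λ i → O i j ℓ)

IsOutlineArray : {k : ℕ} → MultisetArray k → FreqArray k → Set
IsOutlineArray {k} O F =
  (i j ℓ : Fin k) →
    (∣ O i j ∣ₘ ≡ F i j) × (rowCount O i ℓ ≡ F i ℓ) × (colCount O j ℓ ≡ F ℓ j)

HasOutlineArray : {k : ℕ} → FreqArray k → Set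
HasOutlineArray {k} F = Σ (MultisetArray k) (λ O → IsOutlineArray O F)

F-md : (m d k : ℕ) → FreqArray k
F-md m d k i j with ((suc (toℕ i) ≤? m) ⊎-dec (suc (toℕ j) ≤? m)) ×-dec (¬? (toℕ i ≟ toℕ j))
  where open import Data.Nat.Properties using (_≤?_)
        open import Relation.Nullary.Decidable using (¬?)
... | yes _ = 1
... | no _ with ((toℕ i ≟ m) ×-dec (toℕ j ≟ suc m)) ⊎-dec ((toℕ i ≟ suc m) ×-dec (toℕ j ≟ m))
...   | yes _ = d
...   | no _ = 0

module Submission where

-- Identify the first m symbols with ℤ/m.  A Latin square gives each row a and nonzero "class" δ a
-- column col a δ ≠ a (in the simplest case col a δ = a + δ); the cell (a, col a δ) receives the
-- symbol a + e δ, which also reads col a δ + e′ δ for bijections e, e′ fixing 0 (e is doubling), so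
-- every row and column of this block meets every other block symbol once.  The symbols m, m + 1 and
-- the r symbols beyond them are put into cells of reserved classes; the block symbols they displace
-- fill the new rows and columns, and the d-fold cells of the pair (m, m + 1) take the symbols missed
-- by the rows holding m.  The transpose of such a design is again one, so only row sums need proof.
-- For k = m + 2 and m even, one extra symbol is absorbed into the block via a triangle on three
-- symbols (m = 4 is checked directly); for k = 2m all classes but one are reserved and the rows
-- permute the classes 1, 2, 3 so that the rows holding m and those holding m + 1 are exchanged.

open import Defs
open import Data.Bool using (Bool; true; false; not; _∧_; if_then_else_; T)
open import Data.Bool.Properties using (not-involutive)
import Data.Bool.Properties as Boolₚ
open import Data.Empty using (⊥; ⊥-elim)
open import Data.Fin as Fin using (Fin; toℕ; fromℕ<; splitAt; join; _↑ˡ_; _↑ʳ_)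
open import Data.Fin.Patterns using (0F; 1F; 2F)
open import Data.Fin.Permutation using (permutation)
open import Data.Fin.Properties using (toℕ<n; toℕ-injective; toℕ-fromℕ<; toℕ-↑ˡ; toℕ-↑ʳ; splitAt-↑ˡ; splitAt-↑ʳ; join-splitAt; toℕ-cast; cast-trans; cast-is-id; all?)
import Data.Fin.Properties as Finₚ
open import Data.List using (List; []; _∷_)
open import Data.Maybe using (Maybe; just; nothing; is-just)
import Data.Maybe.Properties as Maybeₚ
open import Data.Nat using (ℕ; zero; suc; pred; _+_; _*_; _∸_; _%_; _<_; _≤_; _<ᵇ_; _≡ᵇ_; z≤n; s≤s; s≤s⁻¹; >-nonZero; ⌊_/2⌋; ⌈_/2⌉)
open import Data.Nat.DivMod using (m%n<n; m≤n⇒[n∸m]%m≡n%m; %-distribˡ-+; %-distribˡ-*; m%n%n≡m%n; [m+n]%n≡m%n; [m+kn]%n≡m%n; m<n⇒m%n≡m; n%n≡0)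
open import Data.Nat.Properties
open import Data.Nat.Tactic.RingSolver using (solve-∀)
open import Data.Product using (_×_; _,_; proj₁; proj₂; Σ)
import Data.Product as Product
open import Data.Sum using (_⊎_; inj₁; inj₂)
import Data.Sum as Sum
open import Data.Sum.Properties using (≡-dec; inj₁-injective; inj₂-injective)
open import Data.Unit using (tt)
open import Function using (_∘_; case_of_)
open import Relation.Binary.PropositionalEquality
open import Relation.Nullary using (Dec; yes; no; ¬_; does)
open import Relation.Nullary.Decidable using (True; toWitness; _⊎-dec_; _×-dec_; _→-dec_; ¬?)
open import Algebra.Properties.CommutativeMonoid.Sum +-0-commutativeMonoid using (sum; sum-cong-≗; ∑-distrib-+; ∑-permute)
open import Algebra.Properties.CommutativeSemigroup +-commutativeSemigroup using (interchange)

false≢true : false ≢ true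
false≢true ()

𝟙[_] : ∀ {ℓ} {X : Set ℓ} → Dec X → ℕ
𝟙[ x? ] = if does x? then 1 else 0

𝟙-yes : ∀ {ℓ} {X : Set ℓ} (x? : Dec X) → X → 𝟙[ x? ] ≡ 1
𝟙-yes (yes _) _ = refl
𝟙-yes (no ¬x) x = ⊥-elim (¬x x)

𝟙-no : ∀ {ℓ} {X : Set ℓ} (x? : Dec X) → ¬ X → 𝟙[ x? ] ≡ 0
𝟙-no (yes x) ¬x = ⊥-elim (¬x x)
𝟙-no (no _) _ = refl

𝟙-cong : ∀ {ℓ ℓ′} {X : Set ℓ} {Y : Set ℓ′} → (X → Y) → (Y → X) →
         (x? : Dec X) (y? : Dec Y) → 𝟙[ x? ] ≡ 𝟙[ y? ]
𝟙-cong f g (yes x) y? = sym (𝟙-yes y? (f x))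
𝟙-cong f g (no ¬x) y? = sym (𝟙-no y? (¬x ∘ g))

∑≡sum : ∀ {n} (f : Fin n → ℕ) → ∑ f ≡ sum f
∑≡sum {zero} f = refl
∑≡sum {suc n} f = cong (f Fin.zero +_) (∑≡sum (f ∘ Fin.suc))

∑-cong : ∀ {n} {f g : Fin n → ℕ} → (∀ i → f i ≡ g i) → ∑ f ≡ ∑ g
∑-cong {f = f} {g} f≗g = trans (∑≡sum f) (trans (sum-cong-≗ f≗g) (sym (∑≡sum g)))

∑-+ : ∀ {n} (f g : Fin n → ℕ) → ∑ (λ i → f i + g i) ≡ ∑ f + ∑ g
∑-+ f g = trans (∑≡sum (λ i → f i + g i)) (trans (∑-distrib-+ f g) (sym (cong₂ _+_ (∑≡sum f) (∑≡sum g))))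

∑-bijection : ∀ {n} (f g : Fin n → Fin n) → (∀ i → g (f i) ≡ i) → (∀ j → f (g j) ≡ j) →
              (h : Fin n → ℕ) → ∑ (h ∘ f) ≡ ∑ h
∑-bijection f g gf fg h =
  trans (∑≡sum (h ∘ f)) (trans (sym (∑-permute h (permutation f g fg gf))) (sym (∑≡sum h)))

∑-zero : ∀ {n} (f : Fin n → ℕ) → (∀ i → f i ≡ 0) → ∑ f ≡ 0
∑-zero {zero} f _ = refl
∑-zero {suc n} f f≗0 rewrite f≗0 Fin.zero = ∑-zero (f ∘ Fin.suc) (f≗0 ∘ Fin.suc)

∑0 : ∀ n → ∑ {n} (λ _ → 0) ≡ 0
∑0 n = ∑-zero {n} (λ _ → 0) λ _ → refl

∑-unique : ∀ {n} (f : Fin n → ℕ) (i₀ : Fin n) → (∀ i → ¬ i ≡ i₀ → f i ≡ 0) → ∑ f ≡ f i₀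
∑-unique {suc n} f Fin.zero others =
  trans (cong (f Fin.zero +_) (∑-zero (f ∘ Fin.suc) (λ i → others (Fin.suc i) λ ())))
        (+-identityʳ _)
∑-unique {suc n} f (Fin.suc i₀) others rewrite others Fin.zero (λ ()) =
  ∑-unique (f ∘ Fin.suc) i₀ (λ i i≢i₀ → others (Fin.suc i) (i≢i₀ ∘ Finₚ.suc-injective))

∑-splitAt : ∀ m {n} (f : Fin (m + n) → ℕ) → ∑ f ≡ ∑ (λ i → f (i ↑ˡ n)) + ∑ (λ j → f (m ↑ʳ j))
∑-splitAt zero f = refl
∑-splitAt (suc m) f = trans (cong (f Fin.zero +_) (∑-splitAt m (f ∘ Fin.suc))) (sym (+-assoc (f Fin.zero) _ _))

∑-const-1 : ∀ n → ∑ {n} (λ _ → 1) ≡ n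
∑-const-1 zero = refl
∑-const-1 (suc n) = cong suc (∑-const-1 n)

∑-complement : ∀ {n} (g : Fin n → Bool) → ∑ (λ a → if g a then 0 else 1) + ∑ (λ a → if g a then 1 else 0) ≡ n
∑-complement {n} g = trans (sym (∑-+ (λ a → if g a then 0 else 1) (λ a → if g a then 1 else 0)))
                           (trans (∑-cong λ a → one (g a)) (∑-const-1 n))
  where
  one : ∀ b → (if b then 0 else 1) + (if b then 1 else 0) ≡ 1
  one true = refl
  one false = refl

count-toℕ≥ : ∀ n L → ∑ {n} (λ a → if toℕ a <ᵇ L then 0 else 1) ≡ n ∸ L
count-toℕ≥ zero zero = refl
count-toℕ≥ zero (suc L) = refl
count-toℕ≥ (suc n) zero = cong suc (count-toℕ≥ n zero)
count-toℕ≥ (suc n) (suc L) = count-toℕ≥ n L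

module _ {m : ℕ} where

  onFin : (f : ℕ → ℕ) → (∀ x → x < m → f x < m) → Fin m → Fin m
  onFin f f< δ = fromℕ< (f< (toℕ δ) (toℕ<n δ))

  toℕ-onFin : ∀ f (f< : ∀ x → x < m → f x < m) δ → toℕ (onFin f f< δ) ≡ f (toℕ δ)
  toℕ-onFin f f< δ = toℕ-fromℕ< (f< (toℕ δ) (toℕ<n δ))

  onFin-inverse : ∀ f g (f< : ∀ x → x < m → f x < m) (g< : ∀ x → x < m → g x < m) →
                  (∀ x → x < m → g (f x) ≡ x) → ∀ δ → onFin g g< (onFin f f< δ) ≡ δ
  onFin-inverse f g f< g< gf δ = toℕ-injective
    (trans (toℕ-onFin g g< _) (trans (cong g (toℕ-onFin f f< δ)) (gf (toℕ δ) (toℕ<n δ))))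

-- A a, P, Q and B b stand for the symbols a, m, m + 1 and m + 2 + b of F-md m d (m + (2 + r)).
Kind : ℕ → ℕ → Set
Kind m r = Fin m ⊎ Fin (2 + r)

pattern A a = inj₁ a
pattern P = inj₂ Fin.zero
pattern Q = inj₂ (Fin.suc Fin.zero)
pattern B b = inj₂ (Fin.suc (Fin.suc b))

module _ {m r : ℕ} where

  _≟ₖ_ : (x y : Kind m r) → Dec (x ≡ y)
  _≟ₖ_ = ≡-dec Fin._≟_ Fin._≟_

  Σk : (Kind m r → ℕ) → ℕ
  Σk g = ∑ (g ∘ inj₁) + ∑ (g ∘ inj₂)

  Σk-cong : {g h : Kind m r → ℕ} → (∀ x → g x ≡ h x) → Σk g ≡ Σk h
  Σk-cong g≗h = cong₂ _+_ (∑-cong (g≗h ∘ inj₁)) (∑-cong (g≗h ∘ inj₂))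

  Σk-zero : (g : Kind m r → ℕ) → (∀ x → g x ≡ 0) → Σk g ≡ 0
  Σk-zero g g≗0 = cong₂ _+_ (∑-zero _ (g≗0 ∘ inj₁)) (∑-zero _ (g≗0 ∘ inj₂))

  Σk-+ : (g h : Kind m r → ℕ) → Σk (λ x → g x + h x) ≡ Σk g + Σk h
  Σk-+ g h = trans (cong₂ _+_ (∑-+ (g ∘ inj₁) (h ∘ inj₁)) (∑-+ (g ∘ inj₂) (h ∘ inj₂)))
                   (interchange (∑ (g ∘ inj₁)) (∑ (h ∘ inj₁)) (∑ (g ∘ inj₂)) (∑ (h ∘ inj₂)))

  Σk-𝟙 : (z : Kind m r) → Σk (λ x → 𝟙[ x ≟ₖ z ]) ≡ 1
  Σk-𝟙 (inj₁ a) = cong₂ _+_ (trans (∑-unique _ a (λ c c≢a → 𝟙-no (inj₁ c ≟ₖ inj₁ a) (c≢a ∘ inj₁-injective)))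
                                   (𝟙-yes (inj₁ a ≟ₖ inj₁ a) refl))
                            (∑-zero _ (λ j → 𝟙-no (inj₂ j ≟ₖ inj₁ a) λ ()))
  Σk-𝟙 (inj₂ j) = cong₂ _+_ (∑-zero _ (λ c → 𝟙-no (inj₁ c ≟ₖ inj₂ j) λ ()))
                            (trans (∑-unique _ j (λ i i≢j → 𝟙-no (inj₂ i ≟ₖ inj₂ j) (i≢j ∘ inj₂-injective)))
                                   (𝟙-yes (inj₂ j ≟ₖ inj₂ j) refl))

  ∑-splitAt-Σk : (g : Kind m r → ℕ) → ∑ (g ∘ splitAt m) ≡ Σk g
  ∑-splitAt-Σk g = trans (∑-splitAt m (g ∘ splitAt m))
    (cong₂ _+_ (∑-cong (λ a → cong g (splitAt-↑ˡ m a (2 + r))))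
               (∑-cong (λ j → cong g (splitAt-↑ʳ m (2 + r) j))))

record IsKindOutline {m r : ℕ} (G : Kind m r → Kind m r → ℕ) (O : Kind m r → Kind m r → Kind m r → ℕ) : Set where
  field
    cells : ∀ x y → Σk (O x y) ≡ G x y
    rows  : ∀ x z → Σk (λ y → O x y z) ≡ G x z
    cols  : ∀ y z → Σk (λ x → O x y z) ≡ G z y

outline-pullback : ∀ {m r k} (κ : Fin k → Kind m r) → (∀ g → ∑ (g ∘ κ) ≡ Σk g) →
                   {F : FreqArray k} {G : Kind m r → Kind m r → ℕ} → (∀ i j → F i j ≡ G (κ i) (κ j)) →
                   {O : Kind m r → Kind m r → Kind m r → ℕ} → IsKindOutline G O → HasOutlineArray F
outline-pullback κ ∑-κ F≡G {O = O} isO =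
  (λ i j ℓ → O (κ i) (κ j) (κ ℓ)) , λ i j ℓ →
    trans (∑-κ (O (κ i) (κ j))) (trans (cells (κ i) (κ j)) (sym (F≡G i j))) ,
    trans (∑-κ (λ y → O (κ i) y (κ ℓ))) (trans (rows (κ i) (κ ℓ)) (sym (F≡G i ℓ))) ,
    trans (∑-κ (λ x → O x (κ j) (κ ℓ))) (trans (cols (κ j) (κ ℓ)) (sym (F≡G ℓ j)))
  where open IsKindOutline isO

IsKindOutline-+ : ∀ {m r} {G₁ G₂ O₁ O₂} → IsKindOutline {m} {r} G₁ O₁ → IsKindOutline G₂ O₂ →
                  IsKindOutline (λ x y → G₁ x y + G₂ x y) (λ x y z → O₁ x y z + O₂ x y z)
IsKindOutline-+ {O₁ = O₁} {O₂} o₁ o₂ = record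
  { cells = λ x y → trans (Σk-+ (O₁ x y) (O₂ x y)) (cong₂ _+_ (cells o₁ x y) (cells o₂ x y))
  ; rows = λ x z → trans (Σk-+ (λ y → O₁ x y z) (λ y → O₂ x y z)) (cong₂ _+_ (rows o₁ x z) (rows o₂ x z))
  ; cols = λ y z → trans (Σk-+ (λ x → O₁ x y z) (λ x → O₂ x y z)) (cong₂ _+_ (cols o₁ y z) (cols o₂ y z)) }
  where open IsKindOutline

freq : ℕ → ℕ → ℕ → ℕ → ℕ
freq m d x y with ((suc x ≤? m) ⊎-dec (suc y ≤? m)) ×-dec (¬? (x ≟ y))
... | yes _ = 1
... | no _ with ((x ≟ m) ×-dec (y ≟ suc m)) ⊎-dec ((x ≟ suc m) ×-dec (y ≟ m))
...   | yes _ = d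
...   | no _ = 0

F-md-toℕ : ∀ m d k (i j : Fin k) → F-md m d k i j ≡ freq m d (toℕ i) (toℕ j)
F-md-toℕ m d k i j with ((suc (toℕ i) ≤? m) ⊎-dec (suc (toℕ j) ≤? m)) ×-dec (¬? (toℕ i ≟ toℕ j))
... | yes _ = refl
... | no _ with ((toℕ i ≟ m) ×-dec (toℕ j ≟ suc m)) ⊎-dec ((toℕ i ≟ suc m) ×-dec (toℕ j ≟ m))
...   | yes _ = refl
...   | no _ = refl

PairPQ : ℕ → ℕ → Set
PairPQ x y = (x ≡ 0 × y ≡ 1) ⊎ (x ≡ 1 × y ≡ 0)

pairPQ? : ∀ x y → Dec (PairPQ x y)
pairPQ? x y = ((x ≟ 0) ×-dec (y ≟ 1)) ⊎-dec ((x ≟ 1) ×-dec (y ≟ 0))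

pairFreq : ℕ → ℕ → ℕ → ℕ
pairFreq d x y with pairPQ? x y
... | yes _ = d
... | no _ = 0

kindFreq : ∀ {m r} → ℕ → Kind m r → Kind m r → ℕ
kindFreq d (inj₁ a) (inj₁ c) = 𝟙[ ¬? (a Fin.≟ c) ]
kindFreq d (inj₁ _) (inj₂ _) = 1
kindFreq d (inj₂ _) (inj₁ _) = 1
kindFreq d (inj₂ i) (inj₂ j) = pairFreq d (toℕ i) (toℕ j)

module _ (m d : ℕ) where

  freq-1 : ∀ x y → (x < m ⊎ y < m) → ¬ x ≡ y → freq m d x y ≡ 1
  freq-1 x y x∨y<m x≢y with ((suc x ≤? m) ⊎-dec (suc y ≤? m)) ×-dec (¬? (x ≟ y))
  ... | yes _ = refl
  ... | no ¬p = ⊥-elim (¬p (x∨y<m , x≢y))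

  freq-diag : ∀ x → freq m d x x ≡ 0
  freq-diag x with ((suc x ≤? m) ⊎-dec (suc x ≤? m)) ×-dec (¬? (x ≟ x))
  ... | yes (_ , x≢x) = ⊥-elim (x≢x refl)
  ... | no _ with ((x ≟ m) ×-dec (x ≟ suc m)) ⊎-dec ((x ≟ suc m) ×-dec (x ≟ m))
  ...   | yes (inj₁ (x≡m , x≡1+m)) = ⊥-elim (1+n≢n (trans (sym x≡1+m) x≡m))
  ...   | yes (inj₂ (x≡1+m , x≡m)) = ⊥-elim (1+n≢n (trans (sym x≡1+m) x≡m))
  ...   | no _ = refl

  freq-≥ : ∀ x y → freq m d (m + x) (m + y) ≡ pairFreq d x y
  freq-≥ x y with ((suc (m + x) ≤? m) ⊎-dec (suc (m + y) ≤? m)) ×-dec (¬? (m + x ≟ m + y))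
  ... | yes (inj₁ m+x<m , _) = ⊥-elim (m+n≮m m x m+x<m)
  ... | yes (inj₂ m+y<m , _) = ⊥-elim (m+n≮m m y m+y<m)
  ... | no _ with ((m + x ≟ m) ×-dec (m + y ≟ suc m)) ⊎-dec ((m + x ≟ suc m) ×-dec (m + y ≟ m)) | pairPQ? x y
  ...   | yes _ | yes _ = refl
  ...   | no _  | no _  = refl
  ...   | yes pq | no ¬pq = ⊥-elim (¬pq (Sum.map (Product.map to0 to1) (Product.map to1 to0) pq))
    where
    to0 : ∀ {z} → m + z ≡ m → z ≡ 0
    to0 eq = +-cancelˡ-≡ m _ 0 (trans eq (sym (+-identityʳ m)))
    to1 : ∀ {z} → m + z ≡ suc m → z ≡ 1
    to1 eq = +-cancelˡ-≡ m _ 1 (trans eq (sym (+-comm m 1)))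
  ...   | no ¬pq | yes pq = ⊥-elim (¬pq (Sum.map (Product.map from0 from1) (Product.map from1 from0) pq))
    where
    from0 : ∀ {z} → z ≡ 0 → m + z ≡ m
    from0 refl = +-identityʳ m
    from1 : ∀ {z} → z ≡ 1 → m + z ≡ suc m
    from1 refl = +-comm m 1

module _ {m r : ℕ} where

  kindIndex : Kind m r → ℕ
  kindIndex (inj₁ a) = toℕ a
  kindIndex (inj₂ j) = m + toℕ j

  toℕ≡kindIndex-splitAt : (i : Fin (m + (2 + r))) → toℕ i ≡ kindIndex (splitAt m i)
  toℕ≡kindIndex-splitAt i = trans (cong toℕ (sym (join-splitAt m (2 + r) i))) (toℕ-join (splitAt m i))
    where
    toℕ-join : ∀ x → toℕ (join m (2 + r) x) ≡ kindIndex x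
    toℕ-join (inj₁ a) = toℕ-↑ˡ a (2 + r)
    toℕ-join (inj₂ j) = toℕ-↑ʳ m j

  freq-kindIndex : ∀ d (x y : Kind m r) → freq m d (kindIndex x) (kindIndex y) ≡ kindFreq d x y
  freq-kindIndex d (inj₁ a) (inj₁ c) with a Fin.≟ c
  ... | yes refl = freq-diag m d (toℕ a)
  ... | no a≢c = freq-1 m d _ _ (inj₁ (toℕ<n a)) (a≢c ∘ toℕ-injective)
  freq-kindIndex d (inj₁ a) (inj₂ j) = freq-1 m d _ _ (inj₁ (toℕ<n a)) (<⇒≢ (<-≤-trans (toℕ<n a) (m≤m+n m _)))
  freq-kindIndex d (inj₂ j) (inj₁ c) = freq-1 m d _ _ (inj₂ (toℕ<n c)) (≢-sym (<⇒≢ (<-≤-trans (toℕ<n c) (m≤m+n m _))))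
  freq-kindIndex d (inj₂ i) (inj₂ j) = freq-≥ m d (toℕ i) (toℕ j)

kindOutline⇒outline : ∀ {m r d} {O : Kind m r → Kind m r → Kind m r → ℕ} →
                      IsKindOutline (kindFreq d) O → HasOutlineArray (F-md m d (m + (2 + r)))
kindOutline⇒outline {m} {r} {d} = outline-pullback (splitAt m) ∑-splitAt-Σk λ i j →
  trans (F-md-toℕ m d _ i j) (trans (cong₂ (freq m d) (toℕ≡kindIndex-splitAt i) (toℕ≡kindIndex-splitAt j))
                                    (freq-kindIndex d (splitAt m i) (splitAt m j)))

pairFreq-sym : ∀ d x y → pairFreq d x y ≡ pairFreq d y x
pairFreq-sym d x y with pairPQ? x y | pairPQ? y x
... | yes _ | yes _ = refl
... | no _ | no _ = refl
... | yes pq | no ¬qp = ⊥-elim (¬qp (Sum.swap (Sum.map Product.swap Product.swap pq)))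
... | no ¬pq | yes qp = ⊥-elim (¬pq (Sum.swap (Sum.map Product.swap Product.swap qp)))

kindFreq-sym : ∀ {m r} d (x y : Kind m r) → kindFreq d x y ≡ kindFreq d y x
kindFreq-sym d (inj₁ a) (inj₁ c) = 𝟙-cong (_∘ sym) (_∘ sym) (¬? (a Fin.≟ c)) (¬? (c Fin.≟ a))
kindFreq-sym d (inj₁ _) (inj₂ _) = refl
kindFreq-sym d (inj₂ _) (inj₁ _) = refl
kindFreq-sym d (inj₂ i) (inj₂ j) = pairFreq-sym d (toℕ i) (toℕ j)

-- The cyclic group ℤ/m

module Cyclic (m₀ : ℕ) where

  m : ℕ
  m = suc m₀

  infixl 6 _⊕_ _⊞_ _⊖_

  ⟦_⟧ : ℕ → Fin m
  ⟦ x ⟧ = fromℕ< (m%n<n x m)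

  toℕ-⟦⟧ : ∀ x → toℕ ⟦ x ⟧ ≡ x % m
  toℕ-⟦⟧ x = toℕ-fromℕ< (m%n<n x m)

  ⟦⟧-cong% : ∀ x y → x % m ≡ y % m → ⟦ x ⟧ ≡ ⟦ y ⟧
  ⟦⟧-cong% x y eq = toℕ-injective (trans (toℕ-⟦⟧ x) (trans eq (sym (toℕ-⟦⟧ y))))

  ⟦⟧-toℕ : ∀ a → ⟦ toℕ a ⟧ ≡ a
  ⟦⟧-toℕ a = toℕ-injective (trans (toℕ-⟦⟧ (toℕ a)) (m<n⇒m%n≡m (toℕ<n a)))

  ⟦⟧-%+ : ∀ x y → ⟦ x % m + y ⟧ ≡ ⟦ x + y ⟧
  ⟦⟧-%+ x y = ⟦⟧-cong% (x % m + y) (x + y) (begin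
    (x % m + y) % m          ≡⟨ %-distribˡ-+ (x % m) y m ⟩
    (x % m % m + y % m) % m  ≡⟨ cong (λ z → (z + y % m) % m) (m%n%n≡m%n x m) ⟩
    (x % m + y % m) % m      ≡⟨ %-distribˡ-+ x y m ⟨
    (x + y) % m              ∎)
    where open ≡-Reasoning

  _⊕_ : Fin m → ℕ → Fin m
  a ⊕ x = ⟦ toℕ a + x ⟧

  _⊞_ : Fin m → Fin m → Fin m
  a ⊞ b = a ⊕ toℕ b

  _⊖_ : Fin m → Fin m → Fin m
  a ⊖ b = a ⊕ (m ∸ toℕ b)

  toℕ-⊕ : ∀ a x → toℕ (a ⊕ x) ≡ (toℕ a + x) % m
  toℕ-⊕ a x = toℕ-⟦⟧ (toℕ a + x)

  ⊕-⊕ : ∀ a x y → a ⊕ x ⊕ y ≡ a ⊕ (x + y)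
  ⊕-⊕ a x y = trans (cong (λ z → ⟦ z + y ⟧) (toℕ-⟦⟧ (toℕ a + x)))
                    (trans (⟦⟧-%+ (toℕ a + x) y) (cong ⟦_⟧ (+-assoc (toℕ a) x y)))

  ⊕-0 : ∀ a → a ⊕ 0 ≡ a
  ⊕-0 a = trans (cong ⟦_⟧ (+-identityʳ (toℕ a))) (⟦⟧-toℕ a)

  ⊕-m : ∀ a → a ⊕ m ≡ a
  ⊕-m a = trans (⟦⟧-cong% (toℕ a + m) (toℕ a) ([m+n]%n≡m%n (toℕ a) m)) (⟦⟧-toℕ a)

  ⊖-⊞ : ∀ a b → a ⊖ b ⊞ b ≡ a
  ⊖-⊞ a b = trans (⊕-⊕ a (m ∸ toℕ b) (toℕ b)) (trans (cong (a ⊕_) (m∸n+n≡m (<⇒≤ (toℕ<n b)))) (⊕-m a))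

  ⊞-⊖ : ∀ a b → a ⊞ b ⊖ b ≡ a
  ⊞-⊖ a b = trans (⊕-⊕ a (toℕ b) (m ∸ toℕ b)) (trans (cong (a ⊕_) (m+[n∸m]≡n (<⇒≤ (toℕ<n b)))) (⊕-m a))

  ⊞-comm : ∀ a b → a ⊞ b ≡ b ⊞ a
  ⊞-comm a b = cong ⟦_⟧ (+-comm (toℕ a) (toℕ b))

  ⊞-assoc : ∀ a b c → a ⊞ b ⊞ c ≡ a ⊞ (b ⊞ c)
  ⊞-assoc a b c = trans (⊕-⊕ a (toℕ b) (toℕ c)) (sym (begin
    ⟦ toℕ a + toℕ ⟦ toℕ b + toℕ c ⟧ ⟧  ≡⟨ cong (λ z → ⟦ toℕ a + z ⟧) (toℕ-⟦⟧ (toℕ b + toℕ c)) ⟩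
    ⟦ toℕ a + (toℕ b + toℕ c) % m ⟧    ≡⟨ cong ⟦_⟧ (+-comm (toℕ a) _) ⟩
    ⟦ (toℕ b + toℕ c) % m + toℕ a ⟧    ≡⟨ ⟦⟧-%+ (toℕ b + toℕ c) (toℕ a) ⟩
    ⟦ toℕ b + toℕ c + toℕ a ⟧          ≡⟨ cong ⟦_⟧ (+-comm _ (toℕ a)) ⟩
    ⟦ toℕ a + (toℕ b + toℕ c) ⟧        ∎))
    where open ≡-Reasoning

  zero-⊞ : ∀ a → Fin.zero ⊞ a ≡ a
  zero-⊞ = ⟦⟧-toℕ

  ⊞-zero : ∀ a → a ⊞ Fin.zero ≡ a
  ⊞-zero = ⊕-0

  ⊞-⊖-cancel : ∀ a c → a ⊞ (c ⊖ a) ≡ c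
  ⊞-⊖-cancel a c = trans (⊞-comm a (c ⊖ a)) (⊖-⊞ c a)

  ⊞-cancelʳ : ∀ a b c → a ⊞ c ≡ b ⊞ c → a ≡ b
  ⊞-cancelʳ a b c eq = trans (sym (⊞-⊖ a c)) (trans (cong (_⊖ c) eq) (⊞-⊖ b c))

  ⊞-cancelˡ : ∀ a x y → a ⊞ x ≡ a ⊞ y → x ≡ y
  ⊞-cancelˡ a x y eq = ⊞-cancelʳ x y a (trans (⊞-comm x a) (trans eq (⊞-comm a y)))

  ⊖-⊖ : ∀ x y z → x ⊖ y ⊖ z ≡ x ⊖ (y ⊞ z)
  ⊖-⊖ x y z = ⊞-cancelʳ _ _ (y ⊞ z) (begin
    x ⊖ y ⊖ z ⊞ (y ⊞ z)  ≡⟨ cong (x ⊖ y ⊖ z ⊞_) (⊞-comm y z) ⟩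
    x ⊖ y ⊖ z ⊞ (z ⊞ y)  ≡⟨ ⊞-assoc (x ⊖ y ⊖ z) z y ⟨
    x ⊖ y ⊖ z ⊞ z ⊞ y    ≡⟨ cong (_⊞ y) (⊖-⊞ (x ⊖ y) z) ⟩
    x ⊖ y ⊞ y            ≡⟨ ⊖-⊞ x y ⟩
    x                    ≡⟨ ⊖-⊞ x (y ⊞ z) ⟨
    x ⊖ (y ⊞ z) ⊞ (y ⊞ z) ∎)
    where open ≡-Reasoning

  ⊖-⊖-swap : ∀ x y z → x ⊖ (y ⊖ z) ≡ x ⊞ z ⊖ y
  ⊖-⊖-swap x y z = ⊞-cancelʳ _ _ y (begin
    x ⊖ (y ⊖ z) ⊞ y            ≡⟨ cong (x ⊖ (y ⊖ z) ⊞_) (⊖-⊞ y z) ⟨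
    x ⊖ (y ⊖ z) ⊞ (y ⊖ z ⊞ z)  ≡⟨ ⊞-assoc (x ⊖ (y ⊖ z)) (y ⊖ z) z ⟨
    x ⊖ (y ⊖ z) ⊞ (y ⊖ z) ⊞ z  ≡⟨ cong (_⊞ z) (⊖-⊞ x (y ⊖ z)) ⟩
    x ⊞ z                      ≡⟨ ⊖-⊞ (x ⊞ z) y ⟨
    x ⊞ z ⊖ y ⊞ y              ∎)
    where open ≡-Reasoning

record Latin (m₀ : ℕ) : Set where
  field
    col row class : Fin (suc m₀) → Fin (suc m₀) → Fin (suc m₀)
    class-col : ∀ a δ → class a (col a δ) ≡ δ
    col-class : ∀ a c → col a (class a c) ≡ c
    row-col : ∀ a δ → row (col a δ) δ ≡ a
    col-row : ∀ c δ → col (row c δ) δ ≡ c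
    col-zero : ∀ a → col a Fin.zero ≡ a

translationLatin : ∀ m₀ → Latin m₀
translationLatin m₀ = record
  { col = _⊞_ ; row = _⊖_ ; class = λ a c → c ⊖ a
  ; class-col = λ a δ → trans (cong (_⊖ a) (⊞-comm a δ)) (⊞-⊖ δ a)
  ; col-class = ⊞-⊖-cancel
  ; row-col = ⊞-⊖
  ; col-row = ⊖-⊞
  ; col-zero = ⊞-zero
  }
  where open Cyclic m₀

record PlainClasses (m₀ r : ℕ) : Set where
  field
    classB : Fin r → Fin (suc m₀)
    whichB : Fin (suc m₀) → Maybe (Fin r)
    whichB-classB : ∀ b → whichB (classB b) ≡ just b
    classB-whichB : ∀ δ b → whichB δ ≡ just b → classB b ≡ δ
    classB≢0 : ∀ b → classB b ≢ Fin.zero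

record SymbolMaps (m₀ : ℕ) : Set where
  field
    e e⁻¹ e′ e′⁻¹ : Fin (suc m₀) → Fin (suc m₀)
    e⁻¹-e : ∀ δ → e⁻¹ (e δ) ≡ δ
    e-e⁻¹ : ∀ y → e (e⁻¹ y) ≡ y
    e-zero : e Fin.zero ≡ Fin.zero
    e′⁻¹-e′ : ∀ δ → e′⁻¹ (e′ δ) ≡ δ
    e′-e′⁻¹ : ∀ y → e′ (e′⁻¹ y) ≡ y
    e′-zero : e′ Fin.zero ≡ Fin.zero

  swap : SymbolMaps m₀
  swap = record
    { e = e′ ; e⁻¹ = e′⁻¹ ; e′ = e ; e′⁻¹ = e⁻¹
    ; e⁻¹-e = e′⁻¹-e′ ; e-e⁻¹ = e′-e′⁻¹ ; e-zero = e′-zero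
    ; e′⁻¹-e′ = e⁻¹-e ; e′-e′⁻¹ = e-e⁻¹ ; e′-zero = e-zero
    }

module Framework (m₀ d r : ℕ) where

  open Cyclic m₀

  record Design : Set where
    field
      latin : Latin m₀
      maps : SymbolMaps m₀
      plain : PlainClasses m₀ r
      classP classQ : Fin m
      classP≢0 : classP ≢ Fin.zero
      classQ≢0 : classQ ≢ Fin.zero
      whichB-classP : PlainClasses.whichB plain classP ≡ nothing
      whichB-classQ : PlainClasses.whichB plain classQ ≡ nothing
      carriesP carriesQ : Fin m → Bool
      carries-disjoint : classP ≡ classQ → ∀ a → carriesP a ≡ true → carriesQ a ≡ true → ⊥
      linked : ∀ a δ → δ ≢ Fin.zero → PlainClasses.whichB plain δ ≡ nothing →
               ¬ (carriesP a ≡ true × δ ≡ classP) → ¬ (carriesQ a ≡ true × δ ≡ classQ) →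
               a ⊞ SymbolMaps.e maps δ ≡ Latin.col latin a δ ⊞ SymbolMaps.e′ maps δ
      balanceP : ∀ s → carriesP (s ⊖ SymbolMaps.e maps classP) ≡
                       carriesQ (Latin.row latin (s ⊖ SymbolMaps.e′ maps classQ) classQ)
      balanceQ : ∀ s → carriesQ (s ⊖ SymbolMaps.e maps classQ) ≡
                       carriesP (Latin.row latin (s ⊖ SymbolMaps.e′ maps classP) classP)
      uncarriedP : ∑ (λ a → if carriesP a then 0 else 1) ≡ d
      uncarriedQ : ∑ (λ a → if carriesQ a then 0 else 1) ≡ d

    open Latin latin public
    open SymbolMaps maps public
    open PlainClasses plain public

  module Construction (D : Design) where
    open Design D

    K : Set
    K = Kind m r

    _≟K_ : (x y : K) → Dec (x ≡ y)
    _≟K_ = _≟ₖ_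

    F′ : K → K → ℕ
    F′ = kindFreq d

    P-cell? : ∀ a δ → Dec (carriesP a ≡ true × δ ≡ classP)
    P-cell? a δ = (carriesP a Boolₚ.≟ true) ×-dec (δ Fin.≟ classP)

    Q-cell? : ∀ a δ → Dec (carriesQ a ≡ true × δ ≡ classQ)
    Q-cell? a δ = (carriesQ a Boolₚ.≟ true) ×-dec (δ Fin.≟ classQ)

    blockSymbol : Fin m → Fin m → K
    blockSymbol a δ with P-cell? a δ | Q-cell? a δ | whichB δ
    ... | yes _ | _     | _       = P
    ... | no _  | yes _ | _       = Q
    ... | no _  | no _  | just b  = B b
    ... | no _  | no _  | nothing = A (a ⊞ e δ)

    blockCell : Fin m → Fin m → K → ℕ
    blockCell a c z with a Fin.≟ c
    ... | yes _ = 0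
    ... | no _ = 𝟙[ z ≟K blockSymbol a (class a c) ]

    O : K → K → K → ℕ
    O (A a) (A c) z = blockCell a c z
    O (A a) P z = 𝟙[ z ≟K (if carriesQ a then A (a ⊞ e classQ) else Q) ]
    O (A a) Q z = 𝟙[ z ≟K (if carriesP a then A (a ⊞ e classP) else P) ]
    O (A a) (B b) z = 𝟙[ z ≟K A (a ⊞ e (classB b)) ]
    O P (A c) z = 𝟙[ z ≟K (if carriesQ (row c classQ) then A (c ⊞ e′ classQ) else Q) ]
    O Q (A c) z = 𝟙[ z ≟K (if carriesP (row c classP) then A (c ⊞ e′ classP) else P) ]
    O (B b) (A c) z = 𝟙[ z ≟K A (c ⊞ e′ (classB b)) ]
    O P Q (A s) = if carriesP (s ⊖ e classP) then 0 else 1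
    O Q P (A s) = if carriesQ (s ⊖ e classQ) then 0 else 1
    O _ _ _ = 0

    class≢0 : ∀ a c → a ≢ c → class a c ≢ Fin.zero
    class≢0 a c a≢c eq = a≢c (trans (sym (col-zero a)) (trans (cong (col a) (sym eq)) (col-class a c)))

    col≢self : ∀ a δ → δ ≢ Fin.zero → col a δ ≢ a
    col≢self a δ δ≢0 eq =
      δ≢0 (trans (sym (class-col a δ)) (trans (cong (class a) (trans eq (sym (col-zero a)))) (class-col a Fin.zero)))

    whichB-zero : whichB Fin.zero ≡ nothing
    whichB-zero with whichB Fin.zero in eq
    ... | just b = ⊥-elim (classB≢0 b (classB-whichB Fin.zero b eq))
    ... | nothing = refl

    whichB-classP≢ : ∀ {δ b} → δ ≡ classP → whichB δ ≢ just b
    whichB-classP≢ refl eq with () ← trans (sym whichB-classP) eq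

    whichB-classQ≢ : ∀ {δ b} → δ ≡ classQ → whichB δ ≢ just b
    whichB-classQ≢ refl eq with () ← trans (sym whichB-classQ) eq

    symbolClass : Fin m → Fin m → Fin m
    symbolClass a s = e⁻¹ (s ⊖ a)

    ⊞-e-symbolClass : ∀ a s → a ⊞ e (symbolClass a s) ≡ s
    ⊞-e-symbolClass a s = trans (cong (a ⊞_) (e-e⁻¹ (s ⊖ a))) (⊞-⊖-cancel a s)

    symbolClass-unique : ∀ a s δ → a ⊞ e δ ≡ s → δ ≡ symbolClass a s
    symbolClass-unique a s δ eq =
      trans (sym (e⁻¹-e δ)) (cong e⁻¹ (⊞-cancelˡ a (e δ) (s ⊖ a) (trans eq (sym (⊞-⊖-cancel a s)))))

    symbolClass≢0 : ∀ a s → a ≢ s → symbolClass a s ≢ Fin.zero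
    symbolClass≢0 a s a≢s eq = a≢s (sym (trans (sym (⊞-e-symbolClass a s)) (trans (cong (λ δ → a ⊞ e δ) eq)
                                                   (trans (cong (a ⊞_) e-zero) (⊞-zero a)))))

    symbolClass-self : ∀ a → symbolClass a a ≡ Fin.zero
    symbolClass-self a = sym (symbolClass-unique a a Fin.zero (trans (cong (a ⊞_) e-zero) (⊞-zero a)))

    blockSymbol≡P : ∀ a δ → blockSymbol a δ ≡ P → carriesP a ≡ true × δ ≡ classP
    blockSymbol≡P a δ eq with P-cell? a δ | Q-cell? a δ | whichB δ
    ... | yes p | _     | _       = p
    ... | no _  | yes _ | _       with () ← eq
    ... | no _  | no _  | just b  with () ← eq
    ... | no _  | no _  | nothing with () ← eq

    blockSymbol≡Q : ∀ a δ → blockSymbol a δ ≡ Q → carriesQ a ≡ true × δ ≡ classQ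
    blockSymbol≡Q a δ eq with P-cell? a δ | Q-cell? a δ | whichB δ
    ... | yes _ | _     | _       with () ← eq
    ... | no _  | yes q | _       = q
    ... | no _  | no _  | just b  with () ← eq
    ... | no _  | no _  | nothing with () ← eq

    blockSymbol≡B : ∀ a δ b → blockSymbol a δ ≡ B b → δ ≡ classB b
    blockSymbol≡B a δ b eq with P-cell? a δ | Q-cell? a δ | whichB δ in w
    ... | yes _ | _     | _       with () ← eq
    ... | no _  | yes _ | _       with () ← eq
    ... | no _  | no _  | just b′ = sym (trans (cong classB (Finₚ.suc-injective (Finₚ.suc-injective (inj₂-injective (sym eq)))))
                                                 (classB-whichB δ b′ w))
    ... | no _  | no _  | nothing with () ← eq

    blockSymbol≡A : ∀ a δ s → blockSymbol a δ ≡ A s → a ⊞ e δ ≡ s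
    blockSymbol≡A a δ s eq with P-cell? a δ | Q-cell? a δ | whichB δ
    ... | yes _ | _     | _       with () ← eq
    ... | no _  | yes _ | _       with () ← eq
    ... | no _  | no _  | just b  with () ← eq
    ... | no _  | no _  | nothing = inj₁-injective eq

    blockSymbol-P : ∀ a → carriesP a ≡ true → blockSymbol a classP ≡ P
    blockSymbol-P a p with P-cell? a classP | Q-cell? a classP | whichB classP
    ... | yes _ | _ | _ = refl
    ... | no ¬p | _ | _ = ⊥-elim (¬p (p , refl))

    blockSymbol-Q : ∀ a → carriesQ a ≡ true → blockSymbol a classQ ≡ Q
    blockSymbol-Q a q with P-cell? a classQ | Q-cell? a classQ | whichB classQ
    ... | yes (p , P≡Q) | _ | _ = ⊥-elim (carries-disjoint (sym P≡Q) a p q)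
    ... | no _ | yes _ | _ = refl
    ... | no _ | no ¬q | _ = ⊥-elim (¬q (q , refl))

    blockSymbol-B : ∀ a b → blockSymbol a (classB b) ≡ B b
    blockSymbol-B a b with P-cell? a (classB b) | Q-cell? a (classB b) | whichB (classB b) in w
    ... | yes (_ , δ≡P) | _ | _ = ⊥-elim (whichB-classP≢ δ≡P (whichB-classB b))
    ... | no _ | yes (_ , δ≡Q) | _ = ⊥-elim (whichB-classQ≢ δ≡Q (whichB-classB b))
    ... | no _ | no _ | just b′ = cong B (Maybeₚ.just-injective (trans (sym w) (whichB-classB b)))
    ... | no _ | no _ | nothing with () ← trans (sym w) (whichB-classB b)

    blockSymbol-A : ∀ a δ → whichB δ ≡ nothing → ¬ (carriesP a ≡ true × δ ≡ classP) →
               ¬ (carriesQ a ≡ true × δ ≡ classQ) → blockSymbol a δ ≡ A (a ⊞ e δ)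
    blockSymbol-A a δ w ¬p ¬q with P-cell? a δ | Q-cell? a δ | whichB δ
    ... | yes p | _ | _ = ⊥-elim (¬p p)
    ... | no _ | yes q | _ = ⊥-elim (¬q q)
    ... | no _ | no _ | just b with () ← w
    ... | no _ | no _ | nothing = refl

    blockCell-≢ : ∀ a c z → a ≢ c → blockCell a c z ≡ 𝟙[ z ≟K blockSymbol a (class a c) ]
    blockCell-≢ a c z a≢c with a Fin.≟ c
    ... | yes a≡c = ⊥-elim (a≢c a≡c)
    ... | no _ = refl

    ∑-rowBlock : ∀ a z δ₀ → δ₀ ≢ Fin.zero → (∀ δ → δ ≢ Fin.zero → blockSymbol a δ ≡ z → δ ≡ δ₀) →
                 ∑ (λ c → blockCell a c z) ≡ 𝟙[ z ≟K blockSymbol a δ₀ ]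
    ∑-rowBlock a z δ₀ δ₀≢0 only-δ₀ =
      trans (∑-unique _ (col a δ₀) others)
            (trans (blockCell-≢ a _ z (col≢self a δ₀ δ₀≢0 ∘ sym))
                   (cong (λ δ → 𝟙[ z ≟K blockSymbol a δ ]) (class-col a δ₀)))
      where
      others : ∀ c → c ≢ col a δ₀ → blockCell a c z ≡ 0
      others c c≢col with a Fin.≟ c
      ... | yes _ = refl
      ... | no a≢c = 𝟙-no (z ≟K blockSymbol a (class a c)) λ z≡ →
              c≢col (trans (sym (col-class a c)) (cong (col a) (only-δ₀ _ (class≢0 a c a≢c) (sym z≡))))

    ∑-rowBlock-none : ∀ a z → (∀ δ → δ ≢ Fin.zero → blockSymbol a δ ≢ z) → ∑ (λ c → blockCell a c z) ≡ 0
    ∑-rowBlock-none a z never = ∑-zero _ λ c → zero-at c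
      where
      zero-at : ∀ c → blockCell a c z ≡ 0
      zero-at c with a Fin.≟ c
      ... | yes _ = refl
      ... | no a≢c = 𝟙-no (z ≟K blockSymbol a (class a c)) λ z≡ → never (class a c) (class≢0 a c a≢c) (sym z≡)

    𝟙-if-≢ : ∀ (b : Bool) {x : Fin m} {Y : K} z → (∀ s → z ≢ A s) → z ≢ Y → 𝟙[ z ≟K (if b then A x else Y) ] ≡ 0
    𝟙-if-≢ true {x} z z≢A _ = 𝟙-no (z ≟K A x) (z≢A x)
    𝟙-if-≢ false {Y = Y} z _ z≢Y = 𝟙-no (z ≟K Y) z≢Y

    𝟙-if-else : ∀ (b : Bool) {x : Fin m} (j : Fin (2 + r)) →
                𝟙[ inj₂ j ≟K (if b then A x else inj₂ j) ] ≡ (if b then 0 else 1)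
    𝟙-if-else true j = refl
    𝟙-if-else false j = 𝟙-yes (inj₂ j ≟K inj₂ j) refl

    ∑-𝟙-if : ∀ (g : Fin m → Bool) x (j : Fin (2 + r)) s →
             ∑ (λ c → 𝟙[ A s ≟K (if g c then A (c ⊞ x) else inj₂ j) ]) ≡ (if g (s ⊖ x) then 1 else 0)
    ∑-𝟙-if g x j s = trans (∑-unique _ (s ⊖ x) others) (at (g (s ⊖ x)))
      where
      at : ∀ b → 𝟙[ A s ≟K (if b then A (s ⊖ x ⊞ x) else inj₂ j) ] ≡ (if b then 1 else 0)
      at true = 𝟙-yes (A s ≟K A (s ⊖ x ⊞ x)) (cong A (sym (⊖-⊞ s x)))
      at false = refl
      others : ∀ c → c ≢ s ⊖ x → 𝟙[ A s ≟K (if g c then A (c ⊞ x) else inj₂ j) ] ≡ 0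
      others c c≢ with g c
      ... | true = 𝟙-no (A s ≟K A (c ⊞ x)) λ eq → c≢ (trans (sym (⊞-⊖ c x)) (cong (_⊖ x) (sym (inj₁-injective eq))))
      ... | false = refl

    ∑-𝟙-translate : ∀ x s → ∑ (λ c → 𝟙[ A s ≟K A (c ⊞ x) ]) ≡ 1
    ∑-𝟙-translate x s = ∑-𝟙-if (λ _ → true) x Fin.zero s

    ∑-uncarried : ∀ (carries : Fin m → Bool) δ →
                  ∑ (λ c → if carries (row c δ) then 0 else 1) ≡ ∑ (λ a → if carries a then 0 else 1)
    ∑-uncarried carries δ = ∑-bijection (λ c → row c δ) (λ a → col a δ) (λ c → col-row c δ) (λ a → row-col a δ)
                                        (λ a → if carries a then 0 else 1)

    ∑-uncarried-⊖ : ∀ (carries : Fin m → Bool) x →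
                    ∑ (λ s → if carries (s ⊖ x) then 0 else 1) ≡ ∑ (λ a → if carries a then 0 else 1)
    ∑-uncarried-⊖ carries x = ∑-bijection (_⊖ x) (_⊞ x) (λ s → ⊖-⊞ s x) (λ a → ⊞-⊖ a x)
                                          (λ a → if carries a then 0 else 1)

    𝟙-if-A : ∀ (b : Bool) x s (j : Fin (2 + r)) →
             𝟙[ A s ≟K (if b then A x else inj₂ j) ] ≡ 𝟙[ (b Boolₚ.≟ true) ×-dec (x Fin.≟ s) ]
    𝟙-if-A true x s j = 𝟙-cong (λ eq → refl , sym (inj₁-injective eq)) (λ (_ , x≡s) → cong A (sym x≡s))
                                (A s ≟K A x) ((true Boolₚ.≟ true) ×-dec (x Fin.≟ s))
    𝟙-if-A false x s j = refl

    ⊞-e≡⇔symbolClass≡ : ∀ a s δ →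
                        (a ⊞ e δ ≡ s → symbolClass a s ≡ δ) × (symbolClass a s ≡ δ → a ⊞ e δ ≡ s)
    ⊞-e≡⇔symbolClass≡ a s δ =
      (λ eq → sym (symbolClass-unique a s δ eq)) , (λ eq → trans (cong (λ δ → a ⊞ e δ) (sym eq)) (⊞-e-symbolClass a s))

    rowA-colP : ∀ a s → O (A a) P (A s) ≡ 𝟙[ Q-cell? a (symbolClass a s) ]
    rowA-colP a s = trans (𝟙-if-A (carriesQ a) (a ⊞ e classQ) s _)
      (𝟙-cong (Product.map₂ (proj₁ (⊞-e≡⇔symbolClass≡ a s classQ)))
              (Product.map₂ (proj₂ (⊞-e≡⇔symbolClass≡ a s classQ)))
              ((carriesQ a Boolₚ.≟ true) ×-dec (a ⊞ e classQ Fin.≟ s)) (Q-cell? a (symbolClass a s)))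

    rowA-colQ : ∀ a s → O (A a) Q (A s) ≡ 𝟙[ P-cell? a (symbolClass a s) ]
    rowA-colQ a s = trans (𝟙-if-A (carriesP a) (a ⊞ e classP) s _)
      (𝟙-cong (Product.map₂ (proj₁ (⊞-e≡⇔symbolClass≡ a s classP)))
              (Product.map₂ (proj₂ (⊞-e≡⇔symbolClass≡ a s classP)))
              ((carriesP a Boolₚ.≟ true) ×-dec (a ⊞ e classP Fin.≟ s)) (P-cell? a (symbolClass a s)))

    rowA-colsB : ∀ a s → ∑ (λ b → O (A a) (B b) (A s)) ≡ (if is-just (whichB (symbolClass a s)) then 1 else 0)
    rowA-colsB a s with whichB (symbolClass a s) in w
    ... | just b₀ = trans (∑-unique _ b₀ others) (𝟙-yes (A s ≟K A (a ⊞ e (classB b₀))) (cong A (sym hit)))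
      where
      hit : a ⊞ e (classB b₀) ≡ s
      hit = trans (cong (λ δ → a ⊞ e δ) (classB-whichB _ b₀ w)) (⊞-e-symbolClass a s)
      others : ∀ b → b ≢ b₀ → 𝟙[ A s ≟K A (a ⊞ e (classB b)) ] ≡ 0
      others b b≢b₀ = 𝟙-no (A s ≟K A (a ⊞ e (classB b))) λ eq → b≢b₀ (Maybeₚ.just-injective
        (trans (sym (whichB-classB b)) (trans (cong whichB (symbolClass-unique a s _ (sym (inj₁-injective eq)))) w)))
    ... | nothing = ∑-zero _ λ b → 𝟙-no (A s ≟K A (a ⊞ e (classB b))) λ eq →
        case trans (sym (whichB-classB b)) (trans (cong whichB (symbolClass-unique a s _ (sym (inj₁-injective eq)))) w) of λ ()

    cell-kinds-partition : ∀ a δ s → a ⊞ e δ ≡ s →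
                           𝟙[ A s ≟K blockSymbol a δ ] + (𝟙[ Q-cell? a δ ] + (𝟙[ P-cell? a δ ] +
                             (if is-just (whichB δ) then 1 else 0))) ≡ 1
    cell-kinds-partition a δ s hit with P-cell? a δ | Q-cell? a δ | whichB δ in w
    ... | yes (p , δ≡P) | yes (q , δ≡Q) | _ = ⊥-elim (carries-disjoint (trans (sym δ≡P) δ≡Q) a p q)
    ... | yes (_ , δ≡P) | no _ | just b = ⊥-elim (whichB-classP≢ δ≡P w)
    ... | no _ | yes (_ , δ≡Q) | just b = ⊥-elim (whichB-classQ≢ δ≡Q w)
    ... | yes p | no ¬q | nothing =
      cong₂ _+_ (𝟙-no (A s ≟K P) λ ()) (cong₂ _+_ (𝟙-no (Q-cell? a δ) ¬q) (cong (_+ 0) (𝟙-yes (P-cell? a δ) p)))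
    ... | no ¬p | yes q | nothing =
      cong₂ _+_ (𝟙-no (A s ≟K Q) λ ()) (cong₂ _+_ (𝟙-yes (Q-cell? a δ) q) (cong (_+ 0) (𝟙-no (P-cell? a δ) ¬p)))
    ... | no ¬p | no ¬q | just b =
      cong₂ _+_ (𝟙-no (A s ≟K B b) λ ()) (cong₂ _+_ (𝟙-no (Q-cell? a δ) ¬q) (cong (_+ 1) (𝟙-no (P-cell? a δ) ¬p)))
    ... | no ¬p | no ¬q | nothing =
      cong₂ _+_ (𝟙-yes (A s ≟K A (a ⊞ e δ)) (cong A (sym hit)))
                (cong₂ _+_ (𝟙-no (Q-cell? a δ) ¬q) (cong (_+ 0) (𝟙-no (P-cell? a δ) ¬p)))

    rowA-block : ∀ a s → a ≢ s → ∑ (λ c → blockCell a c (A s)) ≡ 𝟙[ A s ≟K blockSymbol a (symbolClass a s) ]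
    rowA-block a s a≢s =
      ∑-rowBlock a (A s) _ (symbolClass≢0 a s a≢s) λ δ _ eq → symbolClass-unique a s δ (blockSymbol≡A a δ s eq)

    Σk-parts : ∀ (g : K → ℕ) {x y z w} → ∑ (g ∘ A) ≡ x → g P ≡ y → g Q ≡ z → ∑ (g ∘ B) ≡ w →
               Σk g ≡ x + (y + (z + w))
    Σk-parts g refl refl refl refl = refl

    if+if-not : ∀ b → (if b then 1 else 0) + (if b then 0 else 1) ≡ 1
    if+if-not true = refl
    if+if-not false = refl

    if-balance : ∀ {b b′} → b ≡ b′ → (if b′ then 1 else 0) + ((if b then 0 else 1) + 0) ≡ 1
    if-balance {true} refl = refl
    if-balance {false} refl = refl

    𝟙-blockSymbol-classP : ∀ a b → carriesP a ≡ b → 𝟙[ P ≟K blockSymbol a classP ] ≡ (if b then 1 else 0)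
    𝟙-blockSymbol-classP a true cp = 𝟙-yes (P ≟K blockSymbol a classP) (sym (blockSymbol-P a cp))
    𝟙-blockSymbol-classP a false cp =
      𝟙-no (P ≟K blockSymbol a classP) λ eq → false≢true (trans (sym cp) (proj₁ (blockSymbol≡P a classP (sym eq))))

    𝟙-blockSymbol-classQ : ∀ a b → carriesQ a ≡ b → 𝟙[ Q ≟K blockSymbol a classQ ] ≡ (if b then 1 else 0)
    𝟙-blockSymbol-classQ a true cq = 𝟙-yes (Q ≟K blockSymbol a classQ) (sym (blockSymbol-Q a cq))
    𝟙-blockSymbol-classQ a false cq =
      𝟙-no (Q ≟K blockSymbol a classQ) λ eq → false≢true (trans (sym cq) (proj₁ (blockSymbol≡Q a classQ (sym eq))))

    rowAA : ∀ a s → Σk (λ y → O (A a) y (A s)) ≡ F′ (A a) (A s)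
    rowAA a s with a Fin.≟ s
    ... | yes refl = Σk-parts (λ y → O (A a) y (A a))
        (∑-rowBlock-none a (A a) λ δ δ≢0 eq →
           δ≢0 (trans (symbolClass-unique a a δ (blockSymbol≡A a δ a eq)) (symbolClass-self a)))
        (trans (rowA-colP a a) (𝟙-no (Q-cell? a _) λ (_ , eq) → classQ≢0 (trans (sym eq) (symbolClass-self a))))
        (trans (rowA-colQ a a) (𝟙-no (P-cell? a _) λ (_ , eq) → classP≢0 (trans (sym eq) (symbolClass-self a))))
        (trans (rowA-colsB a a) (trans (cong (λ δ → if is-just (whichB δ) then 1 else 0) (symbolClass-self a))
                                  (cong (λ w → if is-just w then 1 else 0) whichB-zero)))
    ... | no a≢s = trans (Σk-parts (λ y → O (A a) y (A s)) (rowA-block a s a≢s) (rowA-colP a s) (rowA-colQ a s) (rowA-colsB a s))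
                         (cell-kinds-partition a (symbolClass a s) s (⊞-e-symbolClass a s))

    rows : ∀ x z → Σk (λ y → O x y z) ≡ F′ x z
    rows (A a) (A s) = rowAA a s
    rows (A a) P = trans (Σk-parts (λ y → O (A a) y P)
        (∑-rowBlock a P classP classP≢0 λ δ _ eq → proj₂ (blockSymbol≡P a δ eq))
        (𝟙-if-≢ (carriesQ a) P (λ _ ()) λ ())
        (𝟙-if-else (carriesP a) Fin.zero)
        (∑0 r))
      (trans (cong₂ _+_ (𝟙-blockSymbol-classP a (carriesP a) refl) (+-identityʳ _)) (if+if-not (carriesP a)))
    rows (A a) Q = trans (Σk-parts (λ y → O (A a) y Q)
        (∑-rowBlock a Q classQ classQ≢0 λ δ _ eq → proj₂ (blockSymbol≡Q a δ eq))
        (𝟙-if-else (carriesQ a) (Fin.suc Fin.zero))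
        (𝟙-if-≢ (carriesP a) Q (λ _ ()) λ ())
        (∑0 r))
      (trans (cong₂ _+_ (𝟙-blockSymbol-classQ a (carriesQ a) refl) (+-identityʳ _)) (if+if-not (carriesQ a)))
    rows (A a) (B b) = trans (Σk-parts (λ y → O (A a) y (B b))
        (∑-rowBlock a (B b) (classB b) (classB≢0 b) λ δ _ eq → blockSymbol≡B a δ b eq)
        (𝟙-if-≢ (carriesQ a) (B b) (λ _ ()) λ ())
        (𝟙-if-≢ (carriesP a) (B b) (λ _ ()) λ ())
        (∑0 r))
      (trans (+-identityʳ _) (𝟙-yes (B b ≟K blockSymbol a (classB b)) (sym (blockSymbol-B a b))))
    rows P (A s) = trans (Σk-parts (λ y → O P y (A s))
        (∑-𝟙-if (λ c → carriesQ (row c classQ)) (e′ classQ) (Fin.suc Fin.zero) s) refl refl (∑0 r))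
      (if-balance (balanceP s))
    rows P P = Σk-parts (λ y → O P y P)
      (∑-zero (λ c → O P (A c) P) λ c → 𝟙-if-≢ (carriesQ (row c classQ)) P (λ _ ()) λ ()) refl refl (∑0 r)
    rows P Q = trans (Σk-parts (λ y → O P y Q)
        (trans (∑-cong λ c → 𝟙-if-else (carriesQ (row c classQ)) {c ⊞ e′ classQ} (Fin.suc Fin.zero))
               (trans (∑-uncarried carriesQ classQ) uncarriedQ)) refl refl (∑0 r))
      (+-identityʳ d)
    rows P (B b) = Σk-parts (λ y → O P y (B b))
      (∑-zero (λ c → O P (A c) (B b)) λ c → 𝟙-if-≢ (carriesQ (row c classQ)) (B b) (λ _ ()) λ ()) refl refl (∑0 r)
    rows Q (A s) = trans (Σk-parts (λ y → O Q y (A s))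
        (∑-𝟙-if (λ c → carriesP (row c classP)) (e′ classP) Fin.zero s) refl refl (∑0 r))
      (if-balance (balanceQ s))
    rows Q P = trans (Σk-parts (λ y → O Q y P)
        (trans (∑-cong λ c → 𝟙-if-else (carriesP (row c classP)) {c ⊞ e′ classP} Fin.zero)
               (trans (∑-uncarried carriesP classP) uncarriedP)) refl refl (∑0 r))
      (+-identityʳ d)
    rows Q Q = Σk-parts (λ y → O Q y Q)
      (∑-zero (λ c → O Q (A c) Q) λ c → 𝟙-if-≢ (carriesP (row c classP)) Q (λ _ ()) λ ()) refl refl (∑0 r)
    rows Q (B b) = Σk-parts (λ y → O Q y (B b))
      (∑-zero (λ c → O Q (A c) (B b)) λ c → 𝟙-if-≢ (carriesP (row c classP)) (B b) (λ _ ()) λ ()) refl refl (∑0 r)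
    rows (B b) (A s) = trans (Σk-parts (λ y → O (B b) y (A s)) (∑-𝟙-translate (e′ (classB b)) s) refl refl (∑0 r)) refl
    rows (B b) P = Σk-parts (λ y → O (B b) y P) (∑0 m) refl refl (∑0 r)
    rows (B b) Q = Σk-parts (λ y → O (B b) y Q) (∑0 m) refl refl (∑0 r)
    rows (B b) (B b′) = Σk-parts (λ y → O (B b) y (B b′)) (∑0 m) refl refl (∑0 r)

    cells : ∀ x y → Σk (O x y) ≡ F′ x y
    cells (A a) (A c) with a Fin.≟ c
    ... | yes refl = Σk-zero {m} {r} (λ _ → 0) λ _ → refl
    ... | no _ = Σk-𝟙 {m} {r} (blockSymbol a (class a c))
    cells (A a) P = Σk-𝟙 {m} {r} (if carriesQ a then A (a ⊞ e classQ) else Q)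
    cells (A a) Q = Σk-𝟙 {m} {r} (if carriesP a then A (a ⊞ e classP) else P)
    cells (A a) (B b) = Σk-𝟙 {m} {r} (A (a ⊞ e (classB b)))
    cells P (A c) = Σk-𝟙 {m} {r} (if carriesQ (row c classQ) then A (c ⊞ e′ classQ) else Q)
    cells Q (A c) = Σk-𝟙 {m} {r} (if carriesP (row c classP) then A (c ⊞ e′ classP) else P)
    cells (B b) (A c) = Σk-𝟙 {m} {r} (A (c ⊞ e′ (classB b)))
    cells P Q = trans (Σk-parts (O P Q) (trans (∑-uncarried-⊖ carriesP (e classP)) uncarriedP) refl refl (∑0 r)) (+-identityʳ d)
    cells Q P = trans (Σk-parts (O Q P) (trans (∑-uncarried-⊖ carriesQ (e classQ)) uncarriedQ) refl refl (∑0 r)) (+-identityʳ d)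
    cells P P = Σk-zero (O P P) λ _ → refl
    cells Q Q = Σk-zero (O Q Q) λ _ → refl
    cells P (B b) = Σk-zero (O P (B b)) λ _ → refl
    cells Q (B b) = Σk-zero (O Q (B b)) λ _ → refl
    cells (B b) P = Σk-zero (O (B b) P) λ _ → refl
    cells (B b) Q = Σk-zero (O (B b) Q) λ _ → refl
    cells (B b) (B b′) = Σk-zero (O (B b) (B b′)) λ _ → refl

    data CellKind (a δ : Fin m) : Set where
      P-cell : carriesP a ≡ true × δ ≡ classP → CellKind a δ
      Q-cell : ¬ (carriesP a ≡ true × δ ≡ classP) → carriesQ a ≡ true × δ ≡ classQ → CellKind a δ
      B-cell : ∀ b → whichB δ ≡ just b → CellKind a δ
      A-cell : whichB δ ≡ nothing → ¬ (carriesP a ≡ true × δ ≡ classP) → ¬ (carriesQ a ≡ true × δ ≡ classQ) →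
               CellKind a δ

    cellKind : ∀ a δ → CellKind a δ
    cellKind a δ with P-cell? a δ | Q-cell? a δ | whichB δ in w
    ... | yes p | _ | _ = P-cell p
    ... | no ¬p | yes q | _ = Q-cell ¬p q
    ... | no _ | no _ | just b = B-cell b w
    ... | no ¬p | no ¬q | nothing = A-cell w ¬p ¬q

  transpose : Design → Design
  transpose D = record
    { latin = record
      { col = row
      ; row = col
      ; class = λ c a → class a c
      ; class-col = λ c δ → trans (cong (class (row c δ)) (sym (col-row c δ))) (class-col (row c δ) δ)
      ; col-class = λ c a → trans (cong (λ x → row x (class a c)) (sym (col-class a c))) (row-col a (class a c))
      ; row-col = col-row
      ; col-row = row-col
      ; col-zero = λ c → trans (cong (λ x → row x Fin.zero) (sym (col-zero c))) (row-col c Fin.zero)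
      }
    ; maps = SymbolMaps.swap maps
    ; classP = classP ; classQ = classQ ; classP≢0 = classP≢0 ; classQ≢0 = classQ≢0
    ; plain = plain ; whichB-classP = whichB-classP ; whichB-classQ = whichB-classQ
    ; carriesP = λ c → carriesP (row c classP)
    ; carriesQ = λ c → carriesQ (row c classQ)
    ; carries-disjoint = λ P≡Q c p q →
        carries-disjoint P≡Q (row c classP) p (subst (λ δ → carriesQ (row c δ) ≡ true) (sym P≡Q) q)
    ; linked = λ c δ δ≢0 w ¬p ¬q →
        sym (trans (linked (row c δ) δ δ≢0 w (¬p ∘ at-row c δ carriesP classP) (¬q ∘ at-row c δ carriesQ classQ))
                   (cong (_⊞ e′ δ) (col-row c δ)))
    ; balanceP = λ s → trans (sym (balanceQ s)) (cong carriesQ (sym (row-col (s ⊖ e classQ) classQ)))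
    ; balanceQ = λ s → trans (sym (balanceP s)) (cong carriesP (sym (row-col (s ⊖ e classP) classP)))
    ; uncarriedP = trans (∑-uncarried carriesP classP) uncarriedP
    ; uncarriedQ = trans (∑-uncarried carriesQ classQ) uncarriedQ
    }
    where
    open Design D
    open Construction D using (∑-uncarried)
    at-row : ∀ c δ (carries : Fin m → Bool) δ′ →
             carries (row c δ) ≡ true × δ ≡ δ′ → carries (row c δ′) ≡ true × δ ≡ δ′
    at-row c δ carries δ′ (p , refl) = p , refl

  module Transposition (D : Design) where
    open Design D
    private
      module C = Construction D
      module Cᵀ = Construction (transpose D)

    carried-col : ∀ (carries : Fin m → Bool) a δ → carries a ≡ true → carries (row (col a δ) δ) ≡ true
    carried-col carries a δ p = trans (cong carries (row-col a δ)) p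

    blockSymbol-transpose : ∀ a δ → δ ≢ Fin.zero → C.blockSymbol a δ ≡ Cᵀ.blockSymbol (col a δ) δ
    blockSymbol-transpose a δ δ≢0 with C.cellKind a δ
    ... | C.P-cell (p , refl) = trans (C.blockSymbol-P a p) (sym (Cᵀ.blockSymbol-P (col a δ) (carried-col carriesP a δ p)))
    ... | C.Q-cell _ (q , refl) = trans (C.blockSymbol-Q a q) (sym (Cᵀ.blockSymbol-Q (col a δ) (carried-col carriesQ a δ q)))
    ... | C.B-cell b w = trans (cong (C.blockSymbol a) (sym δ≡)) (trans (C.blockSymbol-B a b)
                           (sym (trans (cong (Cᵀ.blockSymbol (col a δ)) (sym δ≡)) (Cᵀ.blockSymbol-B (col a δ) b))))
      where
      δ≡ : classB b ≡ δ
      δ≡ = classB-whichB δ b w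
    ... | C.A-cell w ¬p ¬q =
      trans (C.blockSymbol-A a δ w ¬p ¬q)
            (trans (cong A (linked a δ δ≢0 w ¬p ¬q))
                   (sym (Cᵀ.blockSymbol-A (col a δ) δ w (¬p ∘ carried-from-col carriesP classP)
                                                       (¬q ∘ carried-from-col carriesQ classQ))))
      where
      carried-from-col : ∀ (carries : Fin m → Bool) δ′ →
                      carries (row (col a δ) δ′) ≡ true × δ ≡ δ′ → carries a ≡ true × δ ≡ δ′
      carried-from-col carries δ′ (p , refl) = trans (sym (cong carries (row-col a δ))) p , refl

    O-transpose : ∀ x y z → C.O x y z ≡ Cᵀ.O y x z
    O-transpose (A a) (A c) z with a Fin.≟ c | c Fin.≟ a
    ... | yes refl | yes _ = refl
    ... | yes refl | no c≢a = ⊥-elim (c≢a refl)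
    ... | no a≢c | yes refl = ⊥-elim (a≢c refl)
    ... | no a≢c | no _ = cong (λ w → 𝟙[ z ≟ₖ w ])
      (trans (blockSymbol-transpose a (class a c) (C.class≢0 a c a≢c)) (cong (λ x → Cᵀ.blockSymbol x (class a c)) (col-class a c)))
    O-transpose (A a) P z =
      cong (λ x → 𝟙[ z ≟ₖ (if carriesQ x then A (a ⊞ e classQ) else Q) ]) (sym (row-col a classQ))
    O-transpose (A a) Q z =
      cong (λ x → 𝟙[ z ≟ₖ (if carriesP x then A (a ⊞ e classP) else P) ]) (sym (row-col a classP))
    O-transpose (A a) (B b) z = refl
    O-transpose P (A c) z = refl
    O-transpose Q (A c) z = refl
    O-transpose (B b) (A c) z = refl
    O-transpose P Q (A s) = cong (λ b → if b then 0 else 1) (balanceP s)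
    O-transpose P Q P = refl
    O-transpose P Q Q = refl
    O-transpose P Q (B b) = refl
    O-transpose Q P (A s) = cong (λ b → if b then 0 else 1) (balanceQ s)
    O-transpose Q P P = refl
    O-transpose Q P Q = refl
    O-transpose Q P (B b) = refl
    O-transpose P P z = refl
    O-transpose Q Q z = refl
    O-transpose P (B b) z = refl
    O-transpose Q (B b) z = refl
    O-transpose (B b) P z = refl
    O-transpose (B b) Q z = refl
    O-transpose (B b) (B b′) z = refl

  -- The outline of D, transposed, is the outline of transpose D; so the column sums of D are row sums.
  design⇒kindOutline : (D : Design) → IsKindOutline (kindFreq d) (Construction.O D)
  design⇒kindOutline D = record
    { cells = Construction.cells D
    ; rows = Construction.rows D
    ; cols = λ y z → trans (Σk-cong λ x → O-transpose x y z)
                           (trans (Construction.rows (transpose D) y z) (kindFreq-sym d y z))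
    }
    where open Transposition D

-- Doubling

module _ (M : ℕ) where

  below : (ℕ → ℕ) → ℕ → ℕ
  below f x with x <? M
  ... | yes _ = f x
  ... | no _ = x

  below-< : ∀ f → (∀ x → x < M → f x < M) → ∀ {m} → M ≤ m → ∀ x → x < m → below f x < m
  below-< f f< M≤m x x<m with x <? M
  ... | yes x<M = <-≤-trans (f< x x<M) M≤m
  ... | no _ = x<m

  below-inverse : ∀ f g → (∀ x → x < M → f x < M) → (∀ x → x < M → g (f x) ≡ x) → ∀ x → below g (below f x) ≡ x
  below-inverse f g f< gf x with x <? M
  ... | yes x<M with f x <? M
  ...   | yes _ = gf x x<M
  ...   | no fx≮M = ⊥-elim (fx≮M (f< x x<M))
  below-inverse f g f< gf x | no x≮M with x <? M
  ...   | yes x<M = ⊥-elim (x≮M x<M)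
  ...   | no _ = refl

module Doubling (q : ℕ) where

  M : ℕ
  M = suc (q + q)

  double halve : ℕ → ℕ
  double = below M (λ x → (2 * x) % M)
  halve = below M (λ x → (suc q * x) % M)

  *-%-absorb : ∀ a b → (a * (b % M)) % M ≡ (a * b) % M
  *-%-absorb a b = trans (%-distribˡ-* a (b % M) M)
    (trans (cong (λ z → (a % M * z) % M) (m%n%n≡m%n b M)) (sym (%-distribˡ-* a b M)))

  halve-double : ∀ x → halve (double x) ≡ x
  halve-double = below-inverse M _ _ (λ x _ → m%n<n (2 * x) M) λ x x<M → begin
    (suc q * ((2 * x) % M)) % M  ≡⟨ *-%-absorb (suc q) (2 * x) ⟩
    (suc q * (2 * x)) % M        ≡⟨ cong (_% M) (expand q x) ⟩
    (x + x * M) % M              ≡⟨ [m+kn]%n≡m%n x x M ⟩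
    x % M                        ≡⟨ m<n⇒m%n≡m x<M ⟩
    x                            ∎
    where
    open ≡-Reasoning
    expand : ∀ q x → suc q * (2 * x) ≡ x + x * suc (q + q)
    expand = solve-∀

  double-halve : ∀ x → double (halve x) ≡ x
  double-halve = below-inverse M _ _ (λ x _ → m%n<n (suc q * x) M) λ x x<M → begin
    (2 * ((suc q * x) % M)) % M  ≡⟨ *-%-absorb 2 (suc q * x) ⟩
    (2 * (suc q * x)) % M        ≡⟨ cong (_% M) (expand q x) ⟩
    (x + x * M) % M              ≡⟨ [m+kn]%n≡m%n x x M ⟩
    x % M                        ≡⟨ m<n⇒m%n≡m x<M ⟩
    x                            ∎
    where
    open ≡-Reasoning
    expand : ∀ q x → 2 * (suc q * x) ≡ x + x * suc (q + q)
    expand = solve-∀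

  shift unshift : ℕ → ℕ
  shift x with x ≤? q | x <? M
  ... | yes _ | _ = x
  ... | no _ | yes _ = suc x
  ... | no _ | no _ = suc q
  unshift z with z ≤? q | z ≟ suc q
  ... | yes _ | _ = z
  ... | no _ | yes _ = M
  ... | no _ | no _ = pred z

  shift-< : ∀ x → x < suc M → shift x < suc M
  shift-< x x<1+M with x ≤? q | x <? M
  ... | yes _ | _ = x<1+M
  ... | no _ | yes x<M = s≤s x<M
  ... | no _ | no _ = s≤s (s≤s (m≤m+n q q))

  unshift-< : ∀ z → z < suc M → unshift z < suc M
  unshift-< z z<1+M with z ≤? q | z ≟ suc q
  ... | yes _ | _ = z<1+M
  ... | no _ | yes _ = ≤-refl
  ... | no _ | no _ = ≤-<-trans pred[n]≤n z<1+M

  unshift-shift : ∀ x → x < suc M → unshift (shift x) ≡ x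
  unshift-shift x x<1+M with x ≤? q | x <? M
  ... | yes x≤q | _ with x ≤? q
  ...   | yes _ = refl
  ...   | no x≰q = ⊥-elim (x≰q x≤q)
  unshift-shift x x<1+M | no x≰q | yes x<M with suc x ≤? q | suc x ≟ suc q
  ...   | yes 1+x≤q | _ = ⊥-elim (x≰q (≤-trans (n≤1+n x) 1+x≤q))
  ...   | no _ | yes 1+x≡1+q = ⊥-elim (x≰q (≤-reflexive (suc-injective 1+x≡1+q)))
  ...   | no _ | no _ = refl
  unshift-shift x x<1+M | no x≰q | no x≮M with suc q ≤? q | suc q ≟ suc q
  ...   | yes 1+q≤q | _ = ⊥-elim (1+n≰n 1+q≤q)
  ...   | no _ | no 1+q≢1+q = ⊥-elim (1+q≢1+q refl)
  ...   | no _ | yes _ = ≤-antisym (≮⇒≥ x≮M) (s≤s⁻¹ x<1+M)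

  shift-unshift : ∀ z → z < suc M → shift (unshift z) ≡ z
  shift-unshift z z<1+M with z ≤? q | z ≟ suc q
  ... | yes z≤q | _ with z ≤? q
  ...   | yes _ = refl
  ...   | no z≰q = ⊥-elim (z≰q z≤q)
  shift-unshift z z<1+M | no z≰q | yes refl with M ≤? q | M <? M
  ...   | yes M≤q | _ = ⊥-elim (<-irrefl refl (≤-trans (s≤s (m≤m+n q q)) M≤q))
  ...   | no _ | yes M<M = ⊥-elim (<-irrefl refl M<M)
  ...   | no _ | no _ = refl
  shift-unshift (suc z) z<1+M | no z≰q | no z≢1+q with z ≤? q | z <? M
  ...   | yes z≤q | _ = ⊥-elim (z≢1+q (≤-antisym (s≤s z≤q) (≰⇒> z≰q)))
  ...   | no _ | yes _ = refl
  ...   | no _ | no z≮M = ⊥-elim (z≮M (s≤s⁻¹ z<1+M))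
  shift-unshift zero z<1+M | no z≰q | no _ = ⊥-elim (z≰q z≤n)

  2*x≡x+x : ∀ x → 2 * x ≡ x + x
  2*x≡x+x x = cong (x +_) (+-identityʳ x)

  double-< : ∀ x → x < M → double x ≡ (2 * x) % M
  double-< x x<M with x <? M
  ... | yes _ = refl
  ... | no x≮M = ⊥-elim (x≮M x<M)

  -- For odd m = M the twist is the identity (double δ = δ + δ).  For even m = M + 1, ℤ/m has no
  -- orthomorphism, so double δ = δ + twist δ holds only below M and the designs keep class M special.
  record Twist (ε : ℕ) : Set where
    field
      twist untwist : ℕ → ℕ
      twist-< : ∀ x → x < suc (ε + (q + q)) → twist x < suc (ε + (q + q))
      untwist-< : ∀ x → x < suc (ε + (q + q)) → untwist x < suc (ε + (q + q))
      untwist-twist : ∀ x → x < suc (ε + (q + q)) → untwist (twist x) ≡ x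
      twist-untwist : ∀ x → x < suc (ε + (q + q)) → twist (untwist x) ≡ x
      twist-zero : twist 0 ≡ 0
      double≡+twist : ∀ x → x < M → double x ≡ (x + twist x) % suc (ε + (q + q))

  twist-odd : Twist 0
  twist-odd = record
    { twist = λ x → x ; untwist = λ x → x
    ; twist-< = λ _ x< → x< ; untwist-< = λ _ x< → x<
    ; untwist-twist = λ _ _ → refl ; twist-untwist = λ _ _ → refl
    ; twist-zero = refl
    ; double≡+twist = λ x x<M → trans (double-< x x<M) (cong (_% M) (2*x≡x+x x))
    }

  twist-even : Twist 1
  twist-even = record
    { twist = shift ; untwist = unshift
    ; twist-< = shift-< ; untwist-< = unshift-<
    ; untwist-twist = unshift-shift ; twist-untwist = shift-unshift
    ; twist-zero = shift-zero
    ; double≡+twist = double≡+shift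
    }
    where
    shift-zero : shift 0 ≡ 0
    shift-zero with 0 ≤? q
    ... | yes _ = refl
    ... | no 0≰q = ⊥-elim (0≰q z≤n)
    double≡+shift : ∀ x → x < M → double x ≡ (x + shift x) % suc M
    double≡+shift x x<M with x ≤? q | x <? M
    ... | _ | no x≮M = ⊥-elim (x≮M x<M)
    ... | yes x≤q | yes _ =
      trans (cong (_% M) (2*x≡x+x x)) (trans (m<n⇒m%n≡m x+x<M) (sym (m<n⇒m%n≡m (≤-trans x+x<M (n≤1+n M)))))
      where
      x+x<M : x + x < M
      x+x<M = s≤s (+-mono-≤ x≤q x≤q)
    ... | no x≰q | yes _ = begin
      (2 * x) % M              ≡⟨ cong (_% M) (2*x≡x+x x) ⟩
      (x + x) % M              ≡⟨ m≤n⇒[n∸m]%m≡n%m M≤x+x ⟨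
      (x + x ∸ M) % M          ≡⟨ m<n⇒m%n≡m x+x∸M<M ⟩
      x + x ∸ M                ≡⟨ m<n⇒m%n≡m (<-trans x+x∸M<M (n<1+n M)) ⟨
      (x + x ∸ M) % suc M      ≡⟨ m≤n⇒[n∸m]%m≡n%m (s≤s M≤x+x) ⟩
      suc (x + x) % suc M      ≡⟨ cong (_% suc M) (+-suc x x) ⟨
      (x + suc x) % suc M      ∎
      where
      open ≡-Reasoning
      q<x : q < x
      q<x = ≰⇒> x≰q
      M≤x+x : M ≤ x + x
      M≤x+x = +-mono-≤ q<x (<⇒≤ q<x)
      x+x∸M<M : x + x ∸ M < M
      x+x∸M<M = m<n+o⇒m∸n<o (x + x) M (+-mono-< x<M x<M)

module DoublingMaps (q ε : ℕ) (tw : Doubling.Twist q ε) where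

  open Doubling q
  open Twist tw
  open Cyclic (ε + (q + q))

  M≤m : M ≤ m
  M≤m = s≤s (m≤n+m (q + q) ε)

  double-<m : ∀ x → x < m → double x < m
  double-<m = below-< M _ (λ x _ → m%n<n (2 * x) M) M≤m

  halve-<m : ∀ x → x < m → halve x < m
  halve-<m = below-< M _ (λ x _ → m%n<n (suc q * x) M) M≤m

  e e⁻¹ e′ e′⁻¹ : Fin m → Fin m
  e = onFin double double-<m
  e⁻¹ = onFin halve halve-<m
  e′ = onFin twist twist-<
  e′⁻¹ = onFin untwist untwist-<

  e⁻¹-e : ∀ δ → e⁻¹ (e δ) ≡ δ
  e⁻¹-e = onFin-inverse double halve double-<m halve-<m λ x _ → halve-double x

  e-e⁻¹ : ∀ y → e (e⁻¹ y) ≡ y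
  e-e⁻¹ = onFin-inverse halve double halve-<m double-<m λ x _ → double-halve x

  e′⁻¹-e′ : ∀ δ → e′⁻¹ (e′ δ) ≡ δ
  e′⁻¹-e′ = onFin-inverse twist untwist twist-< untwist-< untwist-twist

  e′-e′⁻¹ : ∀ y → e′ (e′⁻¹ y) ≡ y
  e′-e′⁻¹ = onFin-inverse untwist twist untwist-< twist-< twist-untwist

  e-zero : e Fin.zero ≡ Fin.zero
  e-zero = toℕ-injective (toℕ-onFin double double-<m Fin.zero)

  e′-zero : e′ Fin.zero ≡ Fin.zero
  e′-zero = toℕ-injective (trans (toℕ-onFin twist twist-< Fin.zero) twist-zero)

  e≡⊞e′ : ∀ δ → toℕ δ < M → e δ ≡ δ ⊞ e′ δ
  e≡⊞e′ δ δ<M = toℕ-injective (begin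
    toℕ (e δ)                        ≡⟨ toℕ-onFin double double-<m δ ⟩
    double (toℕ δ)                   ≡⟨ double≡+twist (toℕ δ) δ<M ⟩
    (toℕ δ + twist (toℕ δ)) % m      ≡⟨ cong (λ y → (toℕ δ + y) % m) (toℕ-onFin twist twist-< δ) ⟨
    (toℕ δ + toℕ (e′ δ)) % m         ≡⟨ toℕ-⊕ δ (toℕ (e′ δ)) ⟨
    toℕ (δ ⊞ e′ δ)                   ∎)
    where open ≡-Reasoning

  symbolMaps : SymbolMaps (ε + (q + q))
  symbolMaps = record
    { e = e ; e⁻¹ = e⁻¹ ; e′ = e′ ; e′⁻¹ = e′⁻¹
    ; e⁻¹-e = e⁻¹-e ; e-e⁻¹ = e-e⁻¹ ; e-zero = e-zero
    ; e′⁻¹-e′ = e′⁻¹-e′ ; e′-e′⁻¹ = e′-e′⁻¹ ; e′-zero = e′-zero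
    }

-- Arrays with m + 2 ≤ k ≤ 2m − 1

module TranslationDesign (q ε : ℕ) (ε≤1 : ε ≤ 1) (tw : Doubling.Twist q ε) (L r d : ℕ) (1≤L : 1 ≤ L)
             (L+2+r≡m : L + (2 + r) ≡ suc (ε + (q + q))) (d≤m : d ≤ suc (ε + (q + q)))
             (1+L<M⊎d≡0 : suc L < Doubling.M q ⊎ d ≡ 0) where

  open Cyclic (ε + (q + q))
  open Doubling q using (M)
  open DoublingMaps q ε tw
  open Framework (ε + (q + q)) d r

  2+L+r≡m : suc (suc L) + r ≡ m
  2+L+r≡m = trans (cong suc (sym (+-suc L r))) (trans (sym (+-suc L (suc r))) L+2+r≡m)

  1+L<m : suc L < m
  1+L<m = subst (suc L <_) 2+L+r≡m (s≤s (s≤s (m≤m+n L r)))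

  L<M : L < M
  L<M = s≤s⁻¹ (≤-trans (subst (suc (suc L) ≤_) 2+L+r≡m (m≤m+n (suc (suc L)) r)) (s≤s (+-monoˡ-≤ (q + q) ε≤1)))

  classP classQ : Fin m
  classP = fromℕ< (<-trans (n<1+n L) 1+L<m)
  classQ = fromℕ< 1+L<m

  toℕ-classP : toℕ classP ≡ L
  toℕ-classP = toℕ-fromℕ< (<-trans (n<1+n L) 1+L<m)

  toℕ-classQ : toℕ classQ ≡ suc L
  toℕ-classQ = toℕ-fromℕ< 1+L<m

  B+2+L<m : ∀ (b : Fin r) → suc (suc L) + toℕ b < m
  B+2+L<m b = subst (suc (suc L) + toℕ b <_) 2+L+r≡m (+-monoʳ-< (suc (suc L)) (toℕ<n b))

  plain : PlainClasses (ε + (q + q)) r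
  plain = record
    { classB = classB
    ; whichB = whichB
    ; whichB-classB = whichB-classB
    ; classB-whichB = classB-whichB
    ; classB≢0 = λ b eq → 1+n≢0 {suc L + toℕ b} (trans (sym (toℕ-fromℕ< (B+2+L<m b))) (cong toℕ eq))
    }
    where
    classB : Fin r → Fin m
    classB b = fromℕ< (B+2+L<m b)
    offset< : ∀ x → suc (suc L) ≤ x → x < m → x ∸ suc (suc L) < r
    offset< x 2+L≤x x<m = +-cancelˡ-< (suc (suc L)) _ _ (subst₂ _<_ (sym (m+[n∸m]≡n 2+L≤x)) (sym 2+L+r≡m) x<m)
    whichB : Fin m → Maybe (Fin r)
    whichB δ with suc (suc L) ≤? toℕ δ
    ... | yes 2+L≤δ = just (fromℕ< (offset< (toℕ δ) 2+L≤δ (toℕ<n δ)))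
    ... | no _ = nothing
    whichB-classB : ∀ b → whichB (classB b) ≡ just b
    whichB-classB b with suc (suc L) ≤? toℕ (classB b)
    ... | yes _ = cong just (toℕ-injective (trans (toℕ-fromℕ< _)
                    (trans (cong (_∸ suc (suc L)) (toℕ-fromℕ< (B+2+L<m b))) (m+n∸m≡n (suc (suc L)) (toℕ b)))))
    ... | no 2+L≰ = ⊥-elim (2+L≰ (subst (suc (suc L) ≤_) (sym (toℕ-fromℕ< (B+2+L<m b))) (m≤m+n (suc (suc L)) (toℕ b))))
    classB-whichB : ∀ δ b → whichB δ ≡ just b → classB b ≡ δ
    classB-whichB δ b eq with suc (suc L) ≤? toℕ δ
    classB-whichB δ b refl | yes 2+L≤δ = toℕ-injective (trans (toℕ-fromℕ< (B+2+L<m _))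
      (trans (cong (suc (suc L) +_) (toℕ-fromℕ< (offset< (toℕ δ) 2+L≤δ (toℕ<n δ)))) (m+[n∸m]≡n 2+L≤δ)))

  open PlainClasses plain

  whichB≡nothing⇒≤ : ∀ δ → whichB δ ≡ nothing → toℕ δ ≤ suc L
  whichB≡nothing⇒≤ δ w with suc (suc L) ≤? toℕ δ
  ... | no 2+L≰δ = s≤s⁻¹ (≰⇒> 2+L≰δ)

  -- The rows below m − d hold P; shifting them by e classP ⊖ e classQ gives the rows holding Q,
  -- which is what both balance conditions ask for once e δ = δ ⊞ e′ δ on classP and classQ.
  carriesP carriesQ : Fin m → Bool
  carriesP a = toℕ a <ᵇ (m ∸ d)
  carriesQ a = carriesP (a ⊖ (e classP ⊖ e classQ))

  carriesP-all : d ≡ 0 → ∀ a → carriesP a ≡ true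
  carriesP-all refl a = <⇒<ᵇ≡true (toℕ<n a)
    where
    <⇒<ᵇ≡true : ∀ {x y} → x < y → (x <ᵇ y) ≡ true
    <⇒<ᵇ≡true {x} {y} x<y with x <ᵇ y in eq
    ... | true = refl
    ... | false = ⊥-elim (subst T eq (<⇒<ᵇ x<y))

  classP≢classQ : classP ≢ classQ
  classP≢classQ eq = 1+n≢n (trans (sym toℕ-classQ) (trans (cong toℕ (sym eq)) toℕ-classP))

  linked : ∀ a δ → δ ≢ Fin.zero → whichB δ ≡ nothing →
           ¬ (carriesP a ≡ true × δ ≡ classP) → ¬ (carriesQ a ≡ true × δ ≡ classQ) →
           a ⊞ e δ ≡ a ⊞ δ ⊞ e′ δ
  linked a δ _ w ¬p ¬q with M ≤? toℕ δ
  ... | no M≰δ = trans (cong (a ⊞_) (e≡⊞e′ δ (≰⇒> M≰δ))) (sym (⊞-assoc a δ (e′ δ)))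
  ... | yes M≤δ =
    ⊥-elim (<⇒≱ (Sum.[ ≤-<-trans (whichB≡nothing⇒≤ δ w) , (λ d≡0 → <-trans (δ<L d≡0) L<M) ] 1+L<M⊎d≡0) M≤δ)
    where
    δ<L : d ≡ 0 → toℕ δ < L
    δ<L d≡0 = ≤∧≢⇒< (s≤s⁻¹ (≤∧≢⇒< (whichB≡nothing⇒≤ δ w) δ≢1+L)) δ≢L
      where
      δ≢L : toℕ δ ≢ L
      δ≢L eq = ¬p (carriesP-all d≡0 a , toℕ-injective (trans eq (sym toℕ-classP)))
      δ≢1+L : toℕ δ ≢ suc L
      δ≢1+L eq = ¬q (carriesP-all d≡0 _ , toℕ-injective (trans eq (sym toℕ-classQ)))

  ⊖e′⊖ : ∀ s δ → toℕ δ < M → s ⊖ e′ δ ⊖ δ ≡ s ⊖ e δ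
  ⊖e′⊖ s δ δ<M = trans (⊖-⊖ s (e′ δ) δ) (cong (s ⊖_) (trans (⊞-comm (e′ δ) δ) (sym (e≡⊞e′ δ δ<M))))

  ⊖-carrier-shift : ∀ s → s ⊖ e classQ ⊖ (e classP ⊖ e classQ) ≡ s ⊖ e classP
  ⊖-carrier-shift s = trans (⊖-⊖-swap (s ⊖ e classQ) (e classP) (e classQ)) (cong (_⊖ e classP) (⊖-⊞ s (e classQ)))

  classP<M : suc L < M → toℕ classP < M
  classP<M 1+L<M = subst (_< M) (sym toℕ-classP) (<-trans (n<1+n L) 1+L<M)

  classQ<M : suc L < M → toℕ classQ < M
  classQ<M 1+L<M = subst (_< M) (sym toℕ-classQ) 1+L<M

  both-carried : d ≡ 0 → ∀ x y → carriesP x ≡ carriesP y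
  both-carried d≡0 x y = trans (carriesP-all d≡0 x) (sym (carriesP-all d≡0 y))

  balanceP : ∀ s → carriesP (s ⊖ e classP) ≡ carriesQ (s ⊖ e′ classQ ⊖ classQ)
  balanceP s = Sum.[ (λ 1+L<M → cong carriesP (sym (begin
      s ⊖ e′ classQ ⊖ classQ ⊖ (e classP ⊖ e classQ)
        ≡⟨ cong (_⊖ (e classP ⊖ e classQ)) (⊖e′⊖ s classQ (classQ<M 1+L<M)) ⟩
      s ⊖ e classQ ⊖ (e classP ⊖ e classQ)            ≡⟨ ⊖-carrier-shift s ⟩
      s ⊖ e classP                                    ∎)))
    , (λ d≡0 → both-carried d≡0 _ _) ]′ 1+L<M⊎d≡0
    where open ≡-Reasoning

  balanceQ : ∀ s → carriesQ (s ⊖ e classQ) ≡ carriesP (s ⊖ e′ classP ⊖ classP)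
  balanceQ s = Sum.[ (λ 1+L<M → cong carriesP (trans (⊖-carrier-shift s) (sym (⊖e′⊖ s classP (classP<M 1+L<M)))))
                   , (λ d≡0 → both-carried d≡0 _ _) ]′ 1+L<M⊎d≡0

  uncarriedP : ∑ (λ a → if carriesP a then 0 else 1) ≡ d
  uncarriedP = trans (count-toℕ≥ m (m ∸ d)) (m∸[m∸n]≡n d≤m)

  uncarriedQ : ∑ (λ a → if carriesQ a then 0 else 1) ≡ d
  uncarriedQ = trans (∑-bijection (_⊖ shift) (_⊞ shift) (λ a → ⊖-⊞ a shift) (λ x → ⊞-⊖ x shift)
                                  (λ a → if carriesP a then 0 else 1)) uncarriedP
    where
    shift : Fin m
    shift = e classP ⊖ e classQ

  design : Design
  design = record
    { latin = translationLatin (ε + (q + q))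
    ; maps = symbolMaps
    ; plain = plain
    ; classP = classP ; classQ = classQ
    ; classP≢0 = λ eq → <⇒≢ 1≤L (sym (trans (sym toℕ-classP) (cong toℕ eq)))
    ; classQ≢0 = λ eq → 1+n≢0 (trans (sym toℕ-classQ) (cong toℕ eq))
    ; whichB-classP = whichB-nothing classP (≤-trans (≤-reflexive toℕ-classP) (n≤1+n L))
    ; whichB-classQ = whichB-nothing classQ (≤-reflexive toℕ-classQ)
    ; carriesP = carriesP ; carriesQ = carriesQ
    ; carries-disjoint = λ P≡Q → ⊥-elim (classP≢classQ P≡Q)
    ; linked = linked
    ; balanceP = balanceP ; balanceQ = balanceQ
    ; uncarriedP = uncarriedP ; uncarriedQ = uncarriedQ
    }
    where
    whichB-nothing : ∀ δ → toℕ δ ≤ suc L → whichB δ ≡ nothing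
    whichB-nothing δ δ≤1+L with whichB δ in w
    ... | nothing = refl
    ... | just b = ⊥-elim (<⇒≱ (subst (suc (suc L) ≤_) toℕ-classB (m≤m+n (suc (suc L)) (toℕ b))) δ≤1+L)
      where
      toℕ-classB : suc (suc L) + toℕ b ≡ toℕ δ
      toℕ-classB = trans (sym (toℕ-fromℕ< (B+2+L<m b))) (cong toℕ (classB-whichB δ b w))

  outline : HasOutlineArray (F-md m d (m + (2 + r)))
  outline = kindOutline⇒outline (design⇒kindOutline design)

module Triangle (n : ℕ) where

  K : Set
  K = Kind n 1

  Distinct : Fin 3 → Fin 3 → Fin 3 → Set
  Distinct i j k = i ≢ j × j ≢ k × i ≢ k

  distinct? : ∀ i j k → Dec (Distinct i j k)
  distinct? i j k = ¬? (i Fin.≟ j) ×-dec (¬? (j Fin.≟ k) ×-dec ¬? (i Fin.≟ k))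

  triangle : K → K → K → ℕ
  triangle (inj₂ i) (inj₂ j) (inj₂ k) = 𝟙[ distinct? i j k ]
  triangle _ _ _ = 0

  triangleFreq : K → K → ℕ
  triangleFreq (inj₂ i) (inj₂ j) = 𝟙[ ¬? (i Fin.≟ j) ]
  triangleFreq _ _ = 0

  count-third : ∀ i j → ∑ (λ k → 𝟙[ distinct? i j k ]) ≡ 𝟙[ ¬? (i Fin.≟ j) ]
  count-third 0F 0F = refl
  count-third 0F 1F = refl
  count-third 0F 2F = refl
  count-third 1F 0F = refl
  count-third 1F 1F = refl
  count-third 1F 2F = refl
  count-third 2F 0F = refl
  count-third 2F 1F = refl
  count-third 2F 2F = refl

  triangle-cells : ∀ x y → Σk (triangle x y) ≡ triangleFreq x y
  triangle-cells (inj₁ a) y = Σk-zero (triangle (inj₁ a) y) λ _ → refl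
  triangle-cells (inj₂ i) (inj₁ c) = Σk-zero (triangle (inj₂ i) (inj₁ c)) λ _ → refl
  triangle-cells (inj₂ i) (inj₂ j) = cong₂ _+_ (∑0 n) (count-third i j)

  triangle-swap₂₃ : ∀ x y z → triangle x y z ≡ triangle x z y
  triangle-swap₂₃ (inj₁ _) y z = refl
  triangle-swap₂₃ (inj₂ i) (inj₁ _) (inj₁ _) = refl
  triangle-swap₂₃ (inj₂ i) (inj₁ _) (inj₂ k) = refl
  triangle-swap₂₃ (inj₂ i) (inj₂ j) (inj₁ _) = refl
  triangle-swap₂₃ (inj₂ i) (inj₂ j) (inj₂ k) =
    𝟙-cong (λ (i≢j , j≢k , i≢k) → i≢k , ≢-sym j≢k , i≢j) (λ (i≢k , k≢j , i≢j) → i≢j , ≢-sym k≢j , i≢k)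
           (distinct? i j k) (distinct? i k j)

  triangle-swap₁₃ : ∀ x y z → triangle x y z ≡ triangle z y x
  triangle-swap₁₃ (inj₁ _) (inj₁ _) (inj₁ _) = refl
  triangle-swap₁₃ (inj₁ _) (inj₁ _) (inj₂ _) = refl
  triangle-swap₁₃ (inj₁ _) (inj₂ _) (inj₁ _) = refl
  triangle-swap₁₃ (inj₁ _) (inj₂ _) (inj₂ _) = refl
  triangle-swap₁₃ (inj₂ _) (inj₁ _) (inj₁ _) = refl
  triangle-swap₁₃ (inj₂ _) (inj₁ _) (inj₂ _) = refl
  triangle-swap₁₃ (inj₂ _) (inj₂ _) (inj₁ _) = refl
  triangle-swap₁₃ (inj₂ i) (inj₂ j) (inj₂ k) =
    𝟙-cong (λ (i≢j , j≢k , i≢k) → ≢-sym j≢k , ≢-sym i≢j , ≢-sym i≢k)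
           (λ (k≢j , j≢i , k≢i) → ≢-sym j≢i , ≢-sym k≢j , ≢-sym k≢i)
           (distinct? i j k) (distinct? k j i)

  triangle-outline : IsKindOutline triangleFreq triangle
  triangle-outline = record
    { cells = triangle-cells
    ; rows = λ x z → trans (Σk-cong λ y → triangle-swap₂₃ x y z) (triangle-cells x z)
    ; cols = λ y z → trans (Σk-cong λ x → triangle-swap₁₃ x y z) (triangle-cells z y)
    }

  rotate unrotate : Fin 3 → Fin 3
  rotate 0F = 2F
  rotate 1F = 0F
  rotate 2F = 1F
  unrotate 0F = 1F
  unrotate 1F = 2F
  unrotate 2F = 0F

  unrotate-rotate : ∀ j → unrotate (rotate j) ≡ j
  unrotate-rotate 0F = refl
  unrotate-rotate 1F = refl
  unrotate-rotate 2F = refl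

  rotate-unrotate : ∀ j → rotate (unrotate j) ≡ j
  rotate-unrotate 0F = refl
  rotate-unrotate 1F = refl
  rotate-unrotate 2F = refl

  -- Renaming B 0 as the symbol n turns an outline for (n, d, r = 1) plus the triangle on
  -- {P, Q, B 0} into an outline for (n + 1, d + 1, r = 0).
  κ : Fin (n + 3) → K
  κ i = Sum.map₂ rotate (splitAt n i)

  ∑-κ : ∀ g → ∑ (g ∘ κ) ≡ Σk g
  ∑-κ g = trans (∑-splitAt n (g ∘ κ))
    (cong₂ _+_ (∑-cong λ a → cong (g ∘ Sum.map₂ rotate) (splitAt-↑ˡ n a 3))
               (trans (∑-cong λ j → cong (g ∘ Sum.map₂ rotate) (splitAt-↑ʳ n 3 j))
                      (∑-bijection rotate unrotate unrotate-rotate rotate-unrotate (g ∘ inj₂))))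

  absorbedIndex : K → ℕ
  absorbedIndex (inj₁ a) = toℕ a
  absorbedIndex (inj₂ j) = n + toℕ (unrotate j)

  toℕ≡absorbedIndex-κ : ∀ i → toℕ i ≡ absorbedIndex (κ i)
  toℕ≡absorbedIndex-κ i = trans (cong toℕ (sym (join-splitAt n 3 i))) (toℕ-join (splitAt n i))
    where
    toℕ-join : ∀ x → toℕ (Fin.join n 3 x) ≡ absorbedIndex (Sum.map₂ rotate x)
    toℕ-join (inj₁ a) = toℕ-↑ˡ a 3
    toℕ-join (inj₂ j) = trans (toℕ-↑ʳ n j) (cong (λ k → n + toℕ k) (sym (unrotate-rotate j)))

  module _ (d : ℕ) where

    a<1+n : ∀ (a : Fin n) → toℕ a < suc n
    a<1+n a = <-trans (toℕ<n a) (n<1+n n)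

    a≢n+ : ∀ (a : Fin n) k → toℕ a ≢ n + k
    a≢n+ a k = <⇒≢ (<-≤-trans (toℕ<n a) (m≤m+n n k))

    n+0≢n+1 : n + 0 ≢ n + 1
    n+0≢n+1 eq with () ← +-cancelˡ-≡ n 0 1 eq

    freq-absorbedIndex : ∀ x y → freq (suc n) (suc d) (absorbedIndex x) (absorbedIndex y) ≡ kindFreq d x y + triangleFreq x y
    freq-absorbedIndex (inj₁ a) (inj₁ c) with a Fin.≟ c
    ... | yes refl = freq-diag (suc n) (suc d) (toℕ a)
    ... | no a≢c = freq-1 (suc n) (suc d) _ _ (inj₁ (a<1+n a)) (a≢c ∘ toℕ-injective)
    freq-absorbedIndex (inj₁ a) (inj₂ j) = freq-1 (suc n) (suc d) _ _ (inj₁ (a<1+n a)) (a≢n+ a _)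
    freq-absorbedIndex (inj₂ j) (inj₁ c) = freq-1 (suc n) (suc d) _ _ (inj₂ (a<1+n c)) (≢-sym (a≢n+ c _))
    freq-absorbedIndex (inj₂ 0F) (inj₂ 0F) = freq-diag (suc n) (suc d) (n + 1)
    freq-absorbedIndex (inj₂ 1F) (inj₂ 1F) = freq-diag (suc n) (suc d) (n + 2)
    freq-absorbedIndex (inj₂ 2F) (inj₂ 2F) = freq-diag (suc n) (suc d) (n + 0)
    freq-absorbedIndex (inj₂ 2F) (inj₂ 0F) = freq-1 (suc n) (suc d) _ _ (inj₁ (≤-reflexive (cong suc (+-identityʳ n)))) n+0≢n+1
    freq-absorbedIndex (inj₂ 2F) (inj₂ 1F) = freq-1 (suc n) (suc d) _ _ (inj₁ (≤-reflexive (cong suc (+-identityʳ n))))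
                                     (<⇒≢ (+-monoʳ-< n (s≤s z≤n)))
    freq-absorbedIndex (inj₂ 0F) (inj₂ 2F) =
      freq-1 (suc n) (suc d) _ _ (inj₂ (≤-reflexive (cong suc (+-identityʳ n)))) (≢-sym n+0≢n+1)
    freq-absorbedIndex (inj₂ 1F) (inj₂ 2F) = freq-1 (suc n) (suc d) _ _ (inj₂ (≤-reflexive (cong suc (+-identityʳ n))))
                                     (≢-sym (<⇒≢ (+-monoʳ-< n (s≤s z≤n))))
    freq-absorbedIndex (inj₂ 0F) (inj₂ 1F) =
      trans (cong₂ (freq (suc n) (suc d)) (+-suc n 0) (+-suc n 1)) (trans (freq-≥ (suc n) (suc d) 0 1) (+-comm 1 d))
    freq-absorbedIndex (inj₂ 1F) (inj₂ 0F) =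
      trans (cong₂ (freq (suc n) (suc d)) (+-suc n 1) (+-suc n 0)) (trans (freq-≥ (suc n) (suc d) 1 0) (+-comm 1 d))

  absorb-B : ∀ {d} {O : K → K → K → ℕ} → IsKindOutline (λ x y → kindFreq d x y + triangleFreq x y) O →
             HasOutlineArray (F-md (suc n) (suc d) (n + 3))
  absorb-B {d} = outline-pullback κ ∑-κ λ i j →
    trans (F-md-toℕ (suc n) (suc d) _ i j)
          (trans (cong₂ (freq (suc n) (suc d)) (toℕ≡absorbedIndex-κ i) (toℕ≡absorbedIndex-κ j))
                 (freq-absorbedIndex d (κ i) (κ j)))

fromEntries : List (ℕ × ℕ × ℕ) → Fin 6 → Fin 6 → Fin 6 → ℕ
fromEntries [] i j ℓ = 0
fromEntries ((a , b , c) ∷ es) i j ℓ =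
  (if (toℕ i ≡ᵇ a) ∧ (toℕ j ≡ᵇ b) ∧ (toℕ ℓ ≡ᵇ c) then 1 else 0) + fromEntries es i j ℓ

isOutlineArray? : (O : MultisetArray 6) (F : FreqArray 6) → Dec (IsOutlineArray O F)
isOutlineArray? O F = all? λ i → all? λ j → all? λ ℓ →
  (∣ O i j ∣ₘ ≟ F i j) ×-dec ((rowCount O i ℓ ≟ F i ℓ) ×-dec (colCount O j ℓ ≟ F ℓ j))

entries1 : List (ℕ × ℕ × ℕ)
entries1 =
  (0 , 1 , 2) ∷ (0 , 2 , 1) ∷ (0 , 3 , 4) ∷ (0 , 4 , 5) ∷ (0 , 5 , 3) ∷
  (1 , 0 , 2) ∷ (1 , 2 , 3) ∷ (1 , 3 , 5) ∷ (1 , 4 , 0) ∷ (1 , 5 , 4) ∷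
  (2 , 0 , 4) ∷ (2 , 1 , 5) ∷ (2 , 3 , 0) ∷ (2 , 4 , 3) ∷ (2 , 5 , 1) ∷
  (3 , 0 , 1) ∷ (3 , 1 , 4) ∷ (3 , 2 , 5) ∷ (3 , 4 , 2) ∷ (3 , 5 , 0) ∷
  (4 , 0 , 5) ∷ (4 , 1 , 3) ∷ (4 , 2 , 0) ∷ (4 , 3 , 1) ∷ (4 , 5 , 2) ∷
  (5 , 0 , 3) ∷ (5 , 1 , 0) ∷ (5 , 2 , 4) ∷ (5 , 3 , 2) ∷ (5 , 4 , 1) ∷ []

entries2 : List (ℕ × ℕ × ℕ)
entries2 =
  (0 , 1 , 2) ∷ (0 , 2 , 1) ∷ (0 , 3 , 4) ∷ (0 , 4 , 5) ∷ (0 , 5 , 3) ∷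
  (1 , 0 , 2) ∷ (1 , 2 , 0) ∷ (1 , 3 , 5) ∷ (1 , 4 , 3) ∷ (1 , 5 , 4) ∷
  (2 , 0 , 1) ∷ (2 , 1 , 3) ∷ (2 , 3 , 0) ∷ (2 , 4 , 5) ∷ (2 , 5 , 4) ∷
  (3 , 0 , 4) ∷ (3 , 1 , 0) ∷ (3 , 2 , 5) ∷ (3 , 4 , 1) ∷ (3 , 5 , 2) ∷
  (4 , 0 , 5) ∷ (4 , 1 , 5) ∷ (4 , 2 , 3) ∷ (4 , 3 , 2) ∷ (4 , 5 , 0) ∷ (4 , 5 , 1) ∷
  (5 , 0 , 3) ∷ (5 , 1 , 4) ∷ (5 , 2 , 4) ∷ (5 , 3 , 1) ∷ (5 , 4 , 0) ∷ (5 , 4 , 2) ∷ []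

entries3 : List (ℕ × ℕ × ℕ)
entries3 =
  (0 , 1 , 2) ∷ (0 , 2 , 1) ∷ (0 , 3 , 4) ∷ (0 , 4 , 5) ∷ (0 , 5 , 3) ∷
  (1 , 0 , 2) ∷ (1 , 2 , 3) ∷ (1 , 3 , 0) ∷ (1 , 4 , 5) ∷ (1 , 5 , 4) ∷
  (2 , 0 , 3) ∷ (2 , 1 , 0) ∷ (2 , 3 , 1) ∷ (2 , 4 , 5) ∷ (2 , 5 , 4) ∷
  (3 , 0 , 1) ∷ (3 , 1 , 5) ∷ (3 , 2 , 0) ∷ (3 , 4 , 2) ∷ (3 , 5 , 4) ∷
  (4 , 0 , 5) ∷ (4 , 1 , 3) ∷ (4 , 2 , 5) ∷ (4 , 3 , 5) ∷ (4 , 5 , 0) ∷ (4 , 5 , 1) ∷ (4 , 5 , 2) ∷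
  (5 , 0 , 4) ∷ (5 , 1 , 4) ∷ (5 , 2 , 4) ∷ (5 , 3 , 2) ∷ (5 , 4 , 0) ∷ (5 , 4 , 1) ∷ (5 , 4 , 3) ∷ []

entries4 : List (ℕ × ℕ × ℕ)
entries4 =
  (0 , 1 , 2) ∷ (0 , 2 , 3) ∷ (0 , 3 , 1) ∷ (0 , 4 , 5) ∷ (0 , 5 , 4) ∷
  (1 , 0 , 3) ∷ (1 , 2 , 0) ∷ (1 , 3 , 2) ∷ (1 , 4 , 5) ∷ (1 , 5 , 4) ∷
  (2 , 0 , 1) ∷ (2 , 1 , 3) ∷ (2 , 3 , 0) ∷ (2 , 4 , 5) ∷ (2 , 5 , 4) ∷
  (3 , 0 , 2) ∷ (3 , 1 , 0) ∷ (3 , 2 , 1) ∷ (3 , 4 , 5) ∷ (3 , 5 , 4) ∷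
  (4 , 0 , 5) ∷ (4 , 1 , 5) ∷ (4 , 2 , 5) ∷ (4 , 3 , 5) ∷ (4 , 5 , 0) ∷ (4 , 5 , 1) ∷ (4 , 5 , 2) ∷ (4 , 5 , 3) ∷
  (5 , 0 , 4) ∷ (5 , 1 , 4) ∷ (5 , 2 , 4) ∷ (5 , 3 , 4) ∷ (5 , 4 , 0) ∷ (5 , 4 , 1) ∷ (5 , 4 , 2) ∷ (5 , 4 , 3) ∷ []

-- The triangle argument needs an odd block of size at least 5, so m = 4, k = 6 is checked directly.
outline₄ : ∀ d → 1 ≤ d → d ≤ 4 → HasOutlineArray (F-md 4 d 6)
outline₄ 1 _ _ = fromEntries entries1 , toWitness {a? = isOutlineArray? (fromEntries entries1) (F-md 4 1 6)} _
outline₄ 2 _ _ = fromEntries entries2 , toWitness {a? = isOutlineArray? (fromEntries entries2) (F-md 4 2 6)} _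
outline₄ 3 _ _ = fromEntries entries3 , toWitness {a? = isOutlineArray? (fromEntries entries3) (F-md 4 3 6)} _
outline₄ 4 _ _ = fromEntries entries4 , toWitness {a? = isOutlineArray? (fromEntries entries4) (F-md 4 4 6)} _
outline₄ (suc (suc (suc (suc (suc _))))) _ (s≤s (s≤s (s≤s (s≤s ()))))

-- Arrays with k = 2m

data Pivot : Set where
  to1 to2 to3 : Pivot

data Small : ℕ → Set where
  s1 : Small 1
  s2 : Small 2
  s3 : Small 3

small? : ∀ k → Dec (Small k)
small? 0 = no λ ()
small? 1 = yes s1
small? 2 = yes s2
small? 3 = yes s3
small? (suc (suc (suc (suc _)))) = no λ ()

pivot : Pivot → ℕ
pivot to1 = 1
pivot to2 = 2
pivot to3 = 3

image₁ image₃ : Pivot → Bool → ℕ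
image₁ to1 true = 3
image₁ to1 false = 2
image₁ to2 true = 3
image₁ to2 false = 1
image₁ to3 true = 2
image₁ to3 false = 1
image₃ to1 true = 2
image₃ to1 false = 3
image₃ to2 true = 1
image₃ to2 false = 3
image₃ to3 true = 1
image₃ to3 false = 2

σ : Pivot → Bool → ℕ → ℕ
σ p f 1 = image₁ p f
σ p f 2 = pivot p
σ p f 3 = image₃ p f
σ p f k = k

inverse : Pivot → Bool → Pivot × Bool
inverse to1 true = to3 , true
inverse to3 true = to1 , true
inverse p f = p , f

σ⁻¹ : Pivot → Bool → ℕ → ℕ
σ⁻¹ p f = σ (proj₁ (inverse p f)) (proj₂ (inverse p f))

σ⁻¹-σ : ∀ p f k → σ⁻¹ p f (σ p f k) ≡ k
σ⁻¹-σ p f 0 = refl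
σ⁻¹-σ p f (suc (suc (suc (suc k)))) = refl
σ⁻¹-σ to1 true 1 = refl
σ⁻¹-σ to1 true 2 = refl
σ⁻¹-σ to1 true 3 = refl
σ⁻¹-σ to1 false 1 = refl
σ⁻¹-σ to1 false 2 = refl
σ⁻¹-σ to1 false 3 = refl
σ⁻¹-σ to2 true 1 = refl
σ⁻¹-σ to2 true 2 = refl
σ⁻¹-σ to2 true 3 = refl
σ⁻¹-σ to2 false 1 = refl
σ⁻¹-σ to2 false 2 = refl
σ⁻¹-σ to2 false 3 = refl
σ⁻¹-σ to3 true 1 = refl
σ⁻¹-σ to3 true 2 = refl
σ⁻¹-σ to3 true 3 = refl
σ⁻¹-σ to3 false 1 = refl
σ⁻¹-σ to3 false 2 = refl
σ⁻¹-σ to3 false 3 = refl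

inverse-involutive : ∀ p f → inverse (proj₁ (inverse p f)) (proj₂ (inverse p f)) ≡ (p , f)
inverse-involutive to1 true = refl
inverse-involutive to1 false = refl
inverse-involutive to2 true = refl
inverse-involutive to2 false = refl
inverse-involutive to3 true = refl
inverse-involutive to3 false = refl

σ-σ⁻¹ : ∀ p f k → σ p f (σ⁻¹ p f k) ≡ k
σ-σ⁻¹ p f k = subst (λ (p′ , f′) → σ p′ f′ (σ⁻¹ p f k) ≡ k) (inverse-involutive p f)
                    (σ⁻¹-σ (proj₁ (inverse p f)) (proj₂ (inverse p f)) k)

σ-large : ∀ p f k → ¬ Small k → σ p f k ≡ k
σ-large p f 0 _ = refl
σ-large p f 1 ¬s = ⊥-elim (¬s s1)
σ-large p f 2 ¬s = ⊥-elim (¬s s2)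
σ-large p f 3 ¬s = ⊥-elim (¬s s3)
σ-large p f (suc (suc (suc (suc k)))) _ = refl

σ-small : ∀ p f {k} → Small k → Small (σ p f k)
σ-small p f {k} sk with small? (σ p f k)
... | yes s = s
... | no ¬s = ⊥-elim (¬s (subst Small (sym fixed) sk))
  where
  fixed : σ p f k ≡ k
  fixed = trans (sym (σ-large (proj₁ (inverse p f)) (proj₂ (inverse p f)) (σ p f k) ¬s)) (σ⁻¹-σ p f k)

Adjacent : Pivot → Bool → Pivot → Bool → Set
Adjacent p f p′ f′ = ∀ {k} → Small k → (σ p f k ≡ 3 → σ p′ f′ k ≡ 1) × (σ p′ f′ k ≡ 1 → σ p f k ≡ 3)

module _ (p : Pivot) (f : Bool) (p′ : Pivot) (f′ : Bool) where

  AdjacentAt : ℕ → Set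
  AdjacentAt k = (σ p f k ≡ 3 → σ p′ f′ k ≡ 1) × (σ p′ f′ k ≡ 1 → σ p f k ≡ 3)

  adjacentAt? : ∀ k → Dec (AdjacentAt k)
  adjacentAt? k = ((σ p f k ≟ 3) →-dec (σ p′ f′ k ≟ 1)) ×-dec ((σ p′ f′ k ≟ 1) →-dec (σ p f k ≟ 3))

  adjacent? : Dec (AdjacentAt 1 × AdjacentAt 2 × AdjacentAt 3)
  adjacent? = adjacentAt? 1 ×-dec (adjacentAt? 2 ×-dec adjacentAt? 3)

  adjacent : AdjacentAt 1 × AdjacentAt 2 × AdjacentAt 3 → Adjacent p f p′ f′
  adjacent (a₁ , _ , _) s1 = a₁
  adjacent (_ , a₂ , _) s2 = a₂
  adjacent (_ , _ , a₃) s3 = a₃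

module LocalLatin (m₀ : ℕ) (4≤m : 4 ≤ suc m₀) (pivotOf : Fin (suc m₀) → Pivot) (flipOf : Fin (suc m₀) → Bool)
  (adjacent-rows : ∀ b → Adjacent (pivotOf b) (flipOf b) (pivotOf (Cyclic._⊕_ m₀ b 1)) (flipOf (Cyclic._⊕_ m₀ b 1))) where

  open Cyclic m₀

  perm perm⁻¹ : Fin m → ℕ → ℕ
  perm b = σ (pivotOf b) (flipOf b)
  perm⁻¹ b = σ⁻¹ (pivotOf b) (flipOf b)

  small<m : ∀ {k} → Small k → k < m
  small<m s1 = ≤-trans (s≤s (s≤s z≤n)) 4≤m
  small<m s2 = ≤-trans (s≤s (s≤s (s≤s z≤n))) 4≤m
  small<m s3 = 4≤m

  permutes-below-m : ∀ p f k → k < m → σ p f k < m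
  permutes-below-m p f k k<m with small? k
  ... | yes sk = small<m (σ-small p f sk)
  ... | no ¬sk = subst (_< m) (sym (σ-large p f k ¬sk)) k<m

  permutes-below-m⁻¹ : ∀ p f k → k < m → σ⁻¹ p f k < m
  permutes-below-m⁻¹ p f = permutes-below-m (proj₁ (inverse p f)) (proj₂ (inverse p f))

  permF permF⁻¹ : Fin m → Fin m → Fin m
  permF b = onFin (perm b) (permutes-below-m (pivotOf b) (flipOf b))
  permF⁻¹ b = onFin (perm⁻¹ b) (permutes-below-m⁻¹ (pivotOf b) (flipOf b))

  toℕ-permF : ∀ b δ → toℕ (permF b δ) ≡ perm b (toℕ δ)
  toℕ-permF b = toℕ-onFin (perm b) (permutes-below-m (pivotOf b) (flipOf b))

  permF⁻¹-permF : ∀ b δ → permF⁻¹ b (permF b δ) ≡ δ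
  permF⁻¹-permF b = onFin-inverse (perm b) (perm⁻¹ b)
    (permutes-below-m (pivotOf b) (flipOf b)) (permutes-below-m⁻¹ (pivotOf b) (flipOf b)) λ k _ → σ⁻¹-σ (pivotOf b) (flipOf b) k

  permF-permF⁻¹ : ∀ b δ → permF b (permF⁻¹ b δ) ≡ δ
  permF-permF⁻¹ b = onFin-inverse (perm⁻¹ b) (perm b)
    (permutes-below-m⁻¹ (pivotOf b) (flipOf b)) (permutes-below-m (pivotOf b) (flipOf b)) λ k _ → σ-σ⁻¹ (pivotOf b) (flipOf b) k

  permF-large : ∀ b δ → ¬ Small (toℕ δ) → permF b δ ≡ δ
  permF-large b δ ¬s = toℕ-injective (trans (toℕ-permF b δ) (σ-large (pivotOf b) (flipOf b) (toℕ δ) ¬s))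

  permF-zero : ∀ b → permF b Fin.zero ≡ Fin.zero
  permF-zero b = permF-large b Fin.zero λ ()

  nudge : ℕ → Fin m → Fin m
  nudge 1 b = b ⊕ (m ∸ 1)
  nudge 3 b = b ⊕ 1
  nudge _ b = b

  -- col b δ = ψ δ b ⊕ 2 for the classes 1, 2, 3; adjacency makes ψ δ an involution, hence col · δ a bijection.
  ψ : ℕ → Fin m → Fin m
  ψ k b = nudge (perm b k) b

  m∸1+1 : m ∸ 1 + 1 ≡ m
  m∸1+1 = m∸n+n≡m (≤-trans (s≤s z≤n) 4≤m)

  m∸2+2 : m ∸ 2 + 2 ≡ m
  m∸2+2 = m∸n+n≡m (≤-trans (s≤s (s≤s z≤n)) 4≤m)

  ⊕-m∸ : ∀ b k → m ∸ k + k ≡ m → b ⊕ (m ∸ k) ⊕ k ≡ b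
  ⊕-m∸ b k eq = trans (⊕-⊕ b (m ∸ k) k) (trans (cong (b ⊕_) eq) (⊕-m b))

  ⊕-∸m : ∀ b k → m ∸ k + k ≡ m → b ⊕ k ⊕ (m ∸ k) ≡ b
  ⊕-∸m b k eq = trans (⊕-⊕ b k (m ∸ k)) (trans (cong (b ⊕_) (trans (+-comm k (m ∸ k)) eq)) (⊕-m b))

  ⊕-small : ∀ b {v} → Small v → b ⊕ v ≡ nudge v b ⊕ 2
  ⊕-small b s1 = sym (trans (⊕-⊕ b (m ∸ 1) 2) (trans (cong (b ⊕_) (trans (sym (+-assoc (m ∸ 1) 1 1)) (cong (_+ 1) m∸1+1)))
                                                  (trans (sym (⊕-⊕ b m 1)) (cong (_⊕ 1) (⊕-m b)))))
  ⊕-small b s2 = refl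
  ⊕-small b s3 = sym (⊕-⊕ b 1 2)

  ψ-involutive : ∀ b {k} → Small k → ψ k (ψ k b) ≡ b
  ψ-involutive b {k} sk = by-image (perm b k) refl (σ-small (pivotOf b) (flipOf b) sk)
    where
    by-image : ∀ v → perm b k ≡ v → Small v → ψ k (ψ k b) ≡ b
    by-image .1 eq s1 = trans (cong (λ v → ψ k (nudge v b)) eq)
      (trans (cong (λ v → nudge v (b ⊕ (m ∸ 1)))
                   (proj₂ (adjacent-rows (b ⊕ (m ∸ 1)) sk) (trans (cong (λ x → perm x k) (⊕-m∸ b 1 m∸1+1)) eq)))
             (⊕-m∸ b 1 m∸1+1))
    by-image .2 eq s2 = trans (cong (λ v → ψ k (nudge v b)) eq) (cong (λ v → nudge v b) eq)
    by-image .3 eq s3 = trans (cong (λ v → ψ k (nudge v b)) eq)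
      (trans (cong (λ v → nudge v (b ⊕ 1)) (proj₁ (adjacent-rows b sk) eq)) (⊕-∸m b 1 m∸1+1))

  col : Fin m → Fin m → Fin m
  col b δ = b ⊞ permF b δ

  col-small : ∀ b δ → Small (toℕ δ) → col b δ ≡ ψ (toℕ δ) b ⊕ 2
  col-small b δ sk = trans (cong (b ⊕_) (toℕ-permF b δ)) (⊕-small b (σ-small (pivotOf b) (flipOf b) sk))

  rowAt : Fin m → Fin m → ℕ → Fin m
  rowAt c δ 1 = ψ 1 (c ⊕ (m ∸ 2))
  rowAt c δ 2 = ψ 2 (c ⊕ (m ∸ 2))
  rowAt c δ 3 = ψ 3 (c ⊕ (m ∸ 2))
  rowAt c δ _ = c ⊖ δ

  row : Fin m → Fin m → Fin m
  row c δ = rowAt c δ (toℕ δ)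

  rowAt-small : ∀ c δ {k} → Small k → rowAt c δ k ≡ ψ k (c ⊕ (m ∸ 2))
  rowAt-small c δ s1 = refl
  rowAt-small c δ s2 = refl
  rowAt-small c δ s3 = refl

  rowAt-large : ∀ c δ k → ¬ Small k → rowAt c δ k ≡ c ⊖ δ
  rowAt-large c δ 0 _ = refl
  rowAt-large c δ 1 ¬s = ⊥-elim (¬s s1)
  rowAt-large c δ 2 ¬s = ⊥-elim (¬s s2)
  rowAt-large c δ 3 ¬s = ⊥-elim (¬s s3)
  rowAt-large c δ (suc (suc (suc (suc k)))) _ = refl

  col-row : ∀ c δ → col (row c δ) δ ≡ c
  col-row c δ with small? (toℕ δ)
  ... | yes sk = trans (cong (λ b → col b δ) (rowAt-small c δ sk))
                   (trans (col-small _ δ sk) (trans (cong (_⊕ 2) (ψ-involutive (c ⊕ (m ∸ 2)) sk)) (⊕-m∸ c 2 m∸2+2)))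
  ... | no ¬sk = trans (cong (λ b → col b δ) (rowAt-large c δ (toℕ δ) ¬sk))
                   (trans (cong ((c ⊖ δ) ⊞_) (permF-large (c ⊖ δ) δ ¬sk)) (⊖-⊞ c δ))

  row-col : ∀ b δ → row (col b δ) δ ≡ b
  row-col b δ with small? (toℕ δ)
  ... | yes sk = trans (rowAt-small (col b δ) δ sk)
                   (trans (cong (λ c → ψ (toℕ δ) (c ⊕ (m ∸ 2))) (col-small b δ sk))
                          (trans (cong (ψ (toℕ δ)) (⊕-∸m (ψ (toℕ δ) b) 2 m∸2+2)) (ψ-involutive b sk)))
  ... | no ¬sk = trans (rowAt-large (col b δ) δ (toℕ δ) ¬sk)
                   (trans (cong (λ x → b ⊞ x ⊖ δ) (permF-large b δ ¬sk)) (⊞-⊖ b δ))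

  latin : Latin m₀
  latin = record
    { col = col
    ; row = row
    ; class = λ b c → permF⁻¹ b (c ⊖ b)
    ; class-col = λ b δ → trans (cong (permF⁻¹ b) (trans (cong (_⊖ b) (⊞-comm b (permF b δ))) (⊞-⊖ (permF b δ) b)))
                                (permF⁻¹-permF b δ)
    ; col-class = λ b c → trans (cong (b ⊞_) (permF-permF⁻¹ b (c ⊖ b))) (⊞-⊖-cancel b c)
    ; row-col = row-col
    ; col-row = col-row
    ; col-zero = λ b → trans (cong (b ⊞_) (permF-zero b)) (⊞-zero b)
    }

module SquareClasses (m₀ r′ : ℕ) (3+r′≡m : 3 + r′ ≡ suc m₀) where

  classB′ : Fin (suc r′) → Fin (3 + r′)
  classB′ Fin.zero = Fin.suc Fin.zero
  classB′ (Fin.suc k) = Fin.suc (Fin.suc (Fin.suc k))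

  whichB′ : Fin (3 + r′) → Maybe (Fin (suc r′))
  whichB′ Fin.zero = nothing
  whichB′ (Fin.suc Fin.zero) = just Fin.zero
  whichB′ (Fin.suc (Fin.suc Fin.zero)) = nothing
  whichB′ (Fin.suc (Fin.suc (Fin.suc k))) = just (Fin.suc k)

  whichB′-classB′ : ∀ b → whichB′ (classB′ b) ≡ just b
  whichB′-classB′ Fin.zero = refl
  whichB′-classB′ (Fin.suc k) = refl

  classB′-whichB′ : ∀ x b → whichB′ x ≡ just b → classB′ b ≡ x
  classB′-whichB′ (Fin.suc Fin.zero) .Fin.zero refl = refl
  classB′-whichB′ (Fin.suc (Fin.suc (Fin.suc k))) .(Fin.suc k) refl = refl

  nonzero-unplain′ : ∀ x → x ≢ Fin.zero → whichB′ x ≡ nothing → x ≡ Fin.suc (Fin.suc Fin.zero)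
  nonzero-unplain′ Fin.zero x≢0 _ = ⊥-elim (x≢0 refl)
  nonzero-unplain′ (Fin.suc (Fin.suc Fin.zero)) _ _ = refl

  toFin : Fin (3 + r′) → Fin (suc m₀)
  toFin = Fin.cast 3+r′≡m

  fromFin : Fin (suc m₀) → Fin (3 + r′)
  fromFin = Fin.cast (sym 3+r′≡m)

  fromFin-toFin : ∀ x → fromFin (toFin x) ≡ x
  fromFin-toFin x = trans (cast-trans 3+r′≡m (sym 3+r′≡m) x) (cast-is-id _ x)

  toFin-fromFin : ∀ x → toFin (fromFin x) ≡ x
  toFin-fromFin x = trans (cast-trans (sym 3+r′≡m) 3+r′≡m x) (cast-is-id _ x)

  toFin≡zero : ∀ x → toFin x ≡ Fin.zero → x ≡ Fin.zero
  toFin≡zero x eq = toℕ-injective (trans (sym (toℕ-cast 3+r′≡m x)) (cong toℕ eq))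

  plain : PlainClasses m₀ (suc r′)
  plain = record
    { classB = toFin ∘ classB′
    ; whichB = whichB′ ∘ fromFin
    ; whichB-classB = λ b → trans (cong whichB′ (fromFin-toFin (classB′ b))) (whichB′-classB′ b)
    ; classB-whichB = λ δ b w → trans (cong toFin (classB′-whichB′ (fromFin δ) b w)) (toFin-fromFin δ)
    ; classB≢0 = λ b eq → classB′≢0 b (toFin≡zero (classB′ b) eq)
    }
    where
    classB′≢0 : ∀ b → classB′ b ≢ Fin.zero
    classB′≢0 Fin.zero ()
    classB′≢0 (Fin.suc _) ()

  two : Fin (suc m₀)
  two = toFin (Fin.suc (Fin.suc Fin.zero))

  toℕ-two : toℕ two ≡ 2
  toℕ-two = toℕ-cast 3+r′≡m _

  two≢0 : two ≢ Fin.zero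
  two≢0 eq with () ← toFin≡zero (Fin.suc (Fin.suc Fin.zero)) eq

  whichB-two : PlainClasses.whichB plain two ≡ nothing
  whichB-two = cong whichB′ (fromFin-toFin (Fin.suc (Fin.suc Fin.zero)))

  unplain⇒two : ∀ δ → δ ≢ Fin.zero → PlainClasses.whichB plain δ ≡ nothing → δ ≡ two
  unplain⇒two δ δ≢0 w = trans (sym (toFin-fromFin δ))
    (cong toFin (nonzero-unplain′ (fromFin δ) (λ eq → δ≢0 (trans (sym (toFin-fromFin δ)) (cong toFin eq))) w))

odd : ℕ → Bool
odd zero = false
odd (suc n) = not (odd n)

odd-double : ∀ n → odd (n + n) ≡ false
odd-double zero = refl
odd-double (suc n) = trans (cong (not ∘ odd) (+-suc n n)) (trans (not-involutive (odd (n + n))) (odd-double n))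

<ᵇ-true : ∀ {x y} → x < y → (x <ᵇ y) ≡ true
<ᵇ-true {x} {y} x<y with x <ᵇ y in eq
... | true = refl
... | false = ⊥-elim (subst T eq (<⇒<ᵇ x<y))

<ᵇ-false : ∀ {x y} → ¬ x < y → (x <ᵇ y) ≡ false
<ᵇ-false {x} {y} x≮y with x <ᵇ y in eq
... | true = ⊥-elim (x≮y (<ᵇ⇒< x y (subst T (sym eq) tt)))
... | false = refl

count-parity : ∀ L n → L ≤ n →
  ∑ {n} (λ a → if (toℕ a <ᵇ L) ∧ not (odd (toℕ a)) then 1 else 0) ≡ ⌈ L /2⌉ ×
  ∑ {n} (λ a → if (toℕ a <ᵇ L) ∧ odd (toℕ a) then 1 else 0) ≡ ⌊ L /2⌋
count-parity zero n _ = ∑-zero {n} (λ a → if (toℕ a <ᵇ 0) ∧ not (odd (toℕ a)) then 1 else 0) (λ _ → refl)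
                      , ∑-zero {n} (λ a → if (toℕ a <ᵇ 0) ∧ odd (toℕ a) then 1 else 0) (λ _ → refl)
count-parity (suc L) (suc n) (s≤s L≤n) =
  cong suc (trans (∑-cong {n} λ a → cong (λ o → if (toℕ a <ᵇ L) ∧ o then 1 else 0) (not-involutive (odd (toℕ a))))
                  (proj₂ (count-parity L n L≤n)))
  , proj₁ (count-parity L n L≤n)

⌈double/2⌉ : ∀ n → ⌈ (n + n) /2⌉ ≡ n
⌈double/2⌉ zero = refl
⌈double/2⌉ (suc n) = trans (cong (λ x → ⌈ suc x /2⌉) (+-suc n n)) (cong suc (⌈double/2⌉ n))

adjacency : ∀ p f p′ f′ → {True (adjacent? p f p′ f′)} → Adjacent p f p′ f′
adjacency p f p′ f′ {ok} = adjacent p f p′ f′ (toWitness {a? = adjacent? p f p′ f′} ok)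

module SquareCommon (q ε : ℕ) (ε≤1 : ε ≤ 1) (tw : Doubling.Twist q ε) (r′ : ℕ) (3+r′≡m : 3 + r′ ≡ suc (ε + (q + q)))
                   (1≤r′ : 1 ≤ r′) where

  open Cyclic (ε + (q + q))
  open Doubling q using (M)
  open DoublingMaps q ε tw
  open SquareClasses (ε + (q + q)) r′ 3+r′≡m

  4≤m : 4 ≤ m
  4≤m = subst (4 ≤_) 3+r′≡m (s≤s (s≤s (s≤s 1≤r′)))

  e-two : e two ≡ two ⊞ e′ two
  e-two = e≡⊞e′ two (subst (_< M) (sym toℕ-two) (≤-trans (s≤s⁻¹ 4≤m) (+-monoˡ-≤ (q + q) ε≤1)))

module SquareDesign (q ε : ℕ) (ε≤1 : ε ≤ 1) (tw : Doubling.Twist q ε) (r′ h′ d : ℕ) (3+r′≡m : 3 + r′ ≡ suc (ε + (q + q)))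
             (1≤r′ : 1 ≤ r′) (2h≤m : suc h′ + suc h′ ≤ suc (ε + (q + q)))
             (d+h≡m : d + suc h′ ≡ suc (ε + (q + q))) where

  open Cyclic (ε + (q + q))
  open DoublingMaps q ε tw
  open SquareClasses (ε + (q + q)) r′ 3+r′≡m
  open SquareCommon q ε ε≤1 tw r′ 3+r′≡m 1≤r′

  h H2 : ℕ
  h = suc h′
  H2 = h + h

  H2-odd-last : odd (pred H2) ≡ true
  H2-odd-last = trans (cong odd (+-suc h′ h′)) (cong not (odd-double h′))

  odd-at-top : ∀ x → x < H2 → ¬ suc x < H2 → odd x ≡ true
  odd-at-top x x<H2 1+x≮H2 = subst (λ y → odd y ≡ true) (sym x≡) H2-odd-last
    where
    x≡ : x ≡ pred H2
    x≡ = cong pred (≤-antisym x<H2 (≮⇒≥ 1+x≮H2))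

  pivotAt : ℕ → Pivot
  pivotAt x = if x <ᵇ H2 then (if odd x then to1 else to3) else to2

  flipAt : ℕ → Bool
  flipAt zero = false
  flipAt (suc x) = odd (m ∸ suc x)

  pivotAt-stripe : ∀ x → x < H2 → pivotAt x ≡ (if odd x then to1 else to3)
  pivotAt-stripe x x<H2 = cong (λ b → if b then (if odd x then to1 else to3) else to2) (<ᵇ-true x<H2)

  pivotAt-rest : ∀ x → ¬ x < H2 → pivotAt x ≡ to2
  pivotAt-rest x x≮H2 = cong (λ b → if b then (if odd x then to1 else to3) else to2) (<ᵇ-false x≮H2)

  flipAt-step : ∀ x → suc (suc x) ≤ m → flipAt (suc x) ≡ not (flipAt (suc (suc x)))
  flipAt-step x 2+x≤m = cong odd (∸-suc m (suc x) 2+x≤m)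
    where
    ∸-suc : ∀ n y → suc y ≤ n → n ∸ y ≡ suc (n ∸ suc y)
    ∸-suc (suc n) zero _ = refl
    ∸-suc (suc n) (suc y) (s≤s le) = ∸-suc n y le

  adjacent-cong : ∀ {p p′ f f′ q q′ g g′} → p ≡ p′ → f ≡ f′ → q ≡ q′ → g ≡ g′ →
                  Adjacent p′ f′ q′ g′ → Adjacent p f q g
  adjacent-cong refl refl refl refl adj = adj

  stripe-stripe : ∀ o c → Adjacent (if o then to1 else to3) (not c) (if not o then to1 else to3) c
  stripe-stripe true true = adjacency to1 false to3 true
  stripe-stripe true false = adjacency to1 true to3 false
  stripe-stripe false true = adjacency to3 false to1 true
  stripe-stripe false false = adjacency to3 true to1 false

  stripe-rest : ∀ c → Adjacent to1 (not c) to2 c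
  stripe-rest true = adjacency to1 false to2 true
  stripe-rest false = adjacency to1 true to2 false

  rest-rest : ∀ c → Adjacent to2 (not c) to2 c
  rest-rest true = adjacency to2 false to2 true
  rest-rest false = adjacency to2 true to2 false

  first-second : ∀ c → Adjacent to3 false to1 c
  first-second true = adjacency to3 false to1 true
  first-second false = adjacency to3 false to1 false

  adjacent-next : ∀ x → suc x < m → Adjacent (pivotAt x) (flipAt x) (pivotAt (suc x)) (flipAt (suc x))
  adjacent-next zero _ = adjacent-cong refl refl (pivotAt-stripe 1 1<H2) refl (first-second (flipAt 1))
    where
    1<H2 : 1 < H2
    1<H2 = s≤s (subst (1 ≤_) (sym (+-suc h′ h′)) (s≤s z≤n))
  adjacent-next (suc y) 2+y<m with suc (suc y) <? H2
  ... | yes 2+y<H2 = adjacent-cong (pivotAt-stripe (suc y) (<-trans (n<1+n _) 2+y<H2)) (flipAt-step y (<⇒≤ 2+y<m))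
                       (pivotAt-stripe (suc (suc y)) 2+y<H2) refl (stripe-stripe (odd (suc y)) (flipAt (suc (suc y))))
  ... | no 2+y≮H2 with suc y <? H2
  ...   | yes 1+y<H2 = adjacent-cong
           (trans (pivotAt-stripe (suc y) 1+y<H2) (cong (λ o → if o then to1 else to3) (odd-at-top (suc y) 1+y<H2 2+y≮H2)))
           (flipAt-step y (<⇒≤ 2+y<m)) (pivotAt-rest (suc (suc y)) 2+y≮H2) refl (stripe-rest (flipAt (suc (suc y))))
  ...   | no 1+y≮H2 = adjacent-cong (pivotAt-rest (suc y) 1+y≮H2) (flipAt-step y (<⇒≤ 2+y<m))
                       (pivotAt-rest (suc (suc y)) 2+y≮H2) refl (rest-rest (flipAt (suc (suc y))))

  adjacent-wrap : ∀ x → suc x ≡ m → Adjacent (pivotAt x) (flipAt x) (pivotAt 0) (flipAt 0)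
  adjacent-wrap zero 1≡m with s≤s () ← ≤-trans 4≤m (≤-reflexive (sym 1≡m))
  adjacent-wrap (suc y) 2+y≡m with suc y <? H2
  ... | yes 1+y<H2 = adjacent-cong
          (trans (pivotAt-stripe (suc y) 1+y<H2) (cong (λ o → if o then to1 else to3) (odd-at-top (suc y) 1+y<H2 2+y≮H2)))
          last-flip refl refl (adjacency to1 true to3 false)
    where
    2+y≮H2 : ¬ suc (suc y) < H2
    2+y≮H2 2+y<H2 = <-irrefl 2+y≡m (≤-trans 2+y<H2 2h≤m)
    last-flip : flipAt (suc y) ≡ true
    last-flip = cong odd (trans (cong (_∸ suc y) (sym 2+y≡m)) (m+n∸n≡m 1 (suc y)))
  ... | no 1+y≮H2 = adjacent-cong (pivotAt-rest (suc y) 1+y≮H2) last-flip refl refl (adjacency to2 true to3 false)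
    where
    last-flip : flipAt (suc y) ≡ true
    last-flip = cong odd (trans (cong (_∸ suc y) (sym 2+y≡m)) (m+n∸n≡m 1 (suc y)))

  pivotOf : Fin m → Pivot
  pivotOf = pivotAt ∘ toℕ

  flipOf : Fin m → Bool
  flipOf = flipAt ∘ toℕ

  toℕ-⊕1 : ∀ b → suc (toℕ b) < m → toℕ (b ⊕ 1) ≡ suc (toℕ b)
  toℕ-⊕1 b 1+b<m = trans (toℕ-⊕ b 1) (trans (cong (_% m) (+-comm (toℕ b) 1)) (m<n⇒m%n≡m 1+b<m))

  toℕ-⊕1-wrap : ∀ b → suc (toℕ b) ≡ m → toℕ (b ⊕ 1) ≡ 0
  toℕ-⊕1-wrap b 1+b≡m = trans (toℕ-⊕ b 1) (trans (cong (_% m) (trans (+-comm (toℕ b) 1) 1+b≡m)) (n%n≡0 m))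

  adjacent-rows : ∀ b → Adjacent (pivotOf b) (flipOf b) (pivotOf (b ⊕ 1)) (flipOf (b ⊕ 1))
  adjacent-rows b with suc (toℕ b) <? m
  ... | yes 1+b<m = subst (λ x → Adjacent (pivotOf b) (flipOf b) (pivotAt x) (flipAt x)) (sym (toℕ-⊕1 b 1+b<m))
                          (adjacent-next (toℕ b) 1+b<m)
  ... | no 1+b≮m = subst (λ x → Adjacent (pivotOf b) (flipOf b) (pivotAt x) (flipAt x)) (sym (toℕ-⊕1-wrap b 1+b≡m))
                         (adjacent-wrap (toℕ b) 1+b≡m)
    where
    1+b≡m : suc (toℕ b) ≡ m
    1+b≡m = ≤-antisym (toℕ<n b) (≮⇒≥ 1+b≮m)

  open LocalLatin (ε + (q + q)) 4≤m pivotOf flipOf adjacent-rows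

  ψ₂ : Fin m → Fin m
  ψ₂ = ψ 2

  ψ₂-even : ∀ z → toℕ z < H2 → odd (toℕ z) ≡ false → toℕ (ψ₂ z) ≡ suc (toℕ z) × suc (toℕ z) < H2
  ψ₂-even z z<H2 even = trans (cong toℕ nudged) (toℕ-⊕1 z (≤-trans 1+z<H2 2h≤m)) , 1+z<H2
    where
    nudged : ψ₂ z ≡ z ⊕ 1
    nudged = cong (λ p → nudge (pivot p) z) (trans (pivotAt-stripe (toℕ z) z<H2) (cong (λ o → if o then to1 else to3) even))
    1+z<H2 : suc (toℕ z) < H2
    1+z<H2 = ≰⇒> λ H2≤1+z → false≢true (trans (sym even) (odd-at-top (toℕ z) z<H2 (λ 1+z<H2 → <⇒≱ 1+z<H2 H2≤1+z)))

  toℕ-⊕m∸1 : ∀ z y → toℕ z ≡ suc y → toℕ (z ⊕ (m ∸ 1)) ≡ y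
  toℕ-⊕m∸1 z y z≡1+y = begin
    toℕ (z ⊕ (m ∸ 1))        ≡⟨ toℕ-⊕ z (m ∸ 1) ⟩
    (toℕ z + (m ∸ 1)) % m    ≡⟨ cong (λ x → (x + (m ∸ 1)) % m) z≡1+y ⟩
    (suc y + (m ∸ 1)) % m    ≡⟨ cong (_% m) (trans (sym (+-suc y (m ∸ 1))) (cong (y +_) (trans (+-comm 1 (m ∸ 1)) m∸1+1))) ⟩
    (y + m) % m              ≡⟨ [m+n]%n≡m%n y m ⟩
    y % m                    ≡⟨ m<n⇒m%n≡m (<-trans (n<1+n y) (subst (_< m) z≡1+y (toℕ<n z))) ⟩
    y                        ∎
    where open ≡-Reasoning

  odd⇒suc : ∀ x → odd x ≡ true → x ≡ suc (pred x)
  odd⇒suc (suc x) _ = refl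

  ψ₂-odd : ∀ z → toℕ z < H2 → odd (toℕ z) ≡ true → toℕ (ψ₂ z) ≡ pred (toℕ z)
  ψ₂-odd z z<H2 odd-z = trans (cong toℕ nudged) (toℕ-⊕m∸1 z (pred (toℕ z)) (odd⇒suc (toℕ z) odd-z))
    where
    nudged : ψ₂ z ≡ z ⊕ (m ∸ 1)
    nudged = cong (λ p → nudge (pivot p) z) (trans (pivotAt-stripe (toℕ z) z<H2) (cong (λ o → if o then to1 else to3) odd-z))

  evenBelow : ℕ → Bool
  evenBelow x = (x <ᵇ H2) ∧ not (odd x)

  evenBelow-true : ∀ x → evenBelow x ≡ true → x < H2 × odd x ≡ false
  evenBelow-true x eq with x <ᵇ H2 in lt | odd x
  ... | true | false = <ᵇ⇒< x H2 (subst T (sym lt) tt) , refl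

  evenBelow-intro : ∀ x → x < H2 → odd x ≡ false → evenBelow x ≡ true
  evenBelow-intro x x<H2 even = cong₂ (λ b o → b ∧ not o) (<ᵇ-true x<H2) even

  -- Only class 2 is not plain; it holds P in the even rows below 2h and Q in their images under ψ₂,
  -- the odd rows below 2h.  The balance conditions then amount to ψ₂ being an involution.
  carriesP carriesQ : Fin m → Bool
  carriesP a = evenBelow (toℕ a)
  carriesQ a = carriesP (ψ₂ a)

  in-stripe-carried : ∀ a → toℕ a < H2 → carriesP a ≡ true ⊎ carriesQ a ≡ true
  in-stripe-carried a a<H2 = by-parity (odd (toℕ a)) refl
    where
    by-parity : ∀ b → odd (toℕ a) ≡ b → carriesP a ≡ true ⊎ carriesQ a ≡ true
    by-parity false o = inj₁ (evenBelow-intro (toℕ a) a<H2 o)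
    by-parity true o = inj₂ (subst (λ x → evenBelow x ≡ true) (sym (ψ₂-odd a a<H2 o))
                              (evenBelow-intro (pred (toℕ a)) (≤-<-trans pred[n]≤n a<H2) pred-even))
      where
      pred-even : odd (pred (toℕ a)) ≡ false
      pred-even = trans (sym (not-involutive _)) (cong not (trans (cong odd (sym (odd⇒suc (toℕ a) o))) o))

  carries-disjoint : ∀ a → carriesP a ≡ true → carriesQ a ≡ true → ⊥
  carries-disjoint a p q with evenBelow-true (toℕ a) p
  ... | a<H2 , even = false≢true (trans (sym odd-next) (cong not even))
    where
    next : toℕ (ψ₂ a) ≡ suc (toℕ a)
    next = proj₁ (ψ₂-even a a<H2 even)
    odd-next : odd (suc (toℕ a)) ≡ false
    odd-next = subst (λ x → odd x ≡ false) next (proj₂ (evenBelow-true (toℕ (ψ₂ a)) q))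

  permF-two : ∀ a → ¬ toℕ a < H2 → permF a two ≡ two
  permF-two a a≮H2 = toℕ-injective (begin
    toℕ (permF a two)            ≡⟨ toℕ-permF a two ⟩
    perm a (toℕ two)             ≡⟨ cong (perm a) toℕ-two ⟩
    pivot (pivotAt (toℕ a))      ≡⟨ cong pivot (pivotAt-rest (toℕ a) a≮H2) ⟩
    2                            ≡⟨ toℕ-two ⟨
    toℕ two                      ∎)
    where open ≡-Reasoning

  linked : ∀ a δ → δ ≢ Fin.zero → PlainClasses.whichB plain δ ≡ nothing →
           ¬ (carriesP a ≡ true × δ ≡ two) → ¬ (carriesQ a ≡ true × δ ≡ two) → a ⊞ e δ ≡ col a δ ⊞ e′ δ
  linked a δ δ≢0 w ¬p ¬q with unplain⇒two δ δ≢0 w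
  ... | refl = begin
    a ⊞ e two               ≡⟨ cong (a ⊞_) e-two ⟩
    a ⊞ (two ⊞ e′ two)      ≡⟨ ⊞-assoc a two (e′ two) ⟨
    a ⊞ two ⊞ e′ two        ≡⟨ cong (λ x → a ⊞ x ⊞ e′ two) (permF-two a outside) ⟨
    col a two ⊞ e′ two      ∎
    where
    open ≡-Reasoning
    outside : ¬ toℕ a < H2
    outside a<H2 with in-stripe-carried a a<H2
    ... | inj₁ p = ¬p (p , refl)
    ... | inj₂ q = ¬q (q , refl)

  row-two : ∀ s → row (s ⊖ e′ two) two ≡ ψ₂ (s ⊖ e two)
  row-two s = begin
    row (s ⊖ e′ two) two            ≡⟨ cong (rowAt (s ⊖ e′ two) two) toℕ-two ⟩
    ψ₂ (s ⊖ e′ two ⊕ (m ∸ 2))       ≡⟨ cong (λ k → ψ₂ (s ⊖ e′ two ⊕ (m ∸ k))) toℕ-two ⟨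
    ψ₂ (s ⊖ e′ two ⊖ two)           ≡⟨ cong ψ₂ (⊖-⊖ s (e′ two) two) ⟩
    ψ₂ (s ⊖ (e′ two ⊞ two))         ≡⟨ cong (λ x → ψ₂ (s ⊖ x)) (trans (⊞-comm (e′ two) two) (sym e-two)) ⟩
    ψ₂ (s ⊖ e two)                  ∎
    where open ≡-Reasoning

  balanceP : ∀ s → carriesP (s ⊖ e two) ≡ carriesQ (row (s ⊖ e′ two) two)
  balanceP s = cong carriesP (sym (trans (cong ψ₂ (row-two s)) (ψ-involutive (s ⊖ e two) s2)))

  balanceQ : ∀ s → carriesQ (s ⊖ e two) ≡ carriesP (row (s ⊖ e′ two) two)
  balanceQ s = cong carriesP (sym (row-two s))

  uncarriedP : ∑ (λ a → if carriesP a then 0 else 1) ≡ d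
  uncarriedP = +-cancelʳ-≡ h _ d (begin
    ∑ (λ a → if carriesP a then 0 else 1) + h
      ≡⟨ cong (∑ (λ a → if carriesP a then 0 else 1) +_)
              (sym (trans (proj₁ (count-parity H2 m 2h≤m)) (⌈double/2⌉ h))) ⟩
    ∑ (λ a → if carriesP a then 0 else 1) + ∑ (λ a → if carriesP a then 1 else 0)
      ≡⟨ ∑-complement carriesP ⟩
    m ≡⟨ d+h≡m ⟨
    d + h ∎)
    where open ≡-Reasoning

  uncarriedQ : ∑ (λ a → if carriesQ a then 0 else 1) ≡ d
  uncarriedQ = trans (∑-bijection ψ₂ ψ₂ (λ a → ψ-involutive a s2) (λ a → ψ-involutive a s2)
                                  (λ a → if carriesP a then 0 else 1)) uncarriedP

  design : Framework.Design (ε + (q + q)) d (suc r′)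
  design = record
    { latin = latin
    ; maps = symbolMaps
    ; plain = plain
    ; classP = two ; classQ = two ; classP≢0 = two≢0 ; classQ≢0 = two≢0
    ; whichB-classP = whichB-two ; whichB-classQ = whichB-two
    ; carriesP = carriesP ; carriesQ = carriesQ
    ; carries-disjoint = λ _ → carries-disjoint
    ; linked = linked
    ; balanceP = balanceP ; balanceQ = balanceQ
    ; uncarriedP = uncarriedP ; uncarriedQ = uncarriedQ
    }

  outline : HasOutlineArray (F-md m d (m + (2 + suc r′)))
  outline = kindOutline⇒outline (Framework.design⇒kindOutline _ _ _ design)

module SaturatedSquareDesign (q ε : ℕ) (ε≤1 : ε ≤ 1) (tw : Doubling.Twist q ε) (r′ : ℕ)
                      (3+r′≡m : 3 + r′ ≡ suc (ε + (q + q))) (1≤r′ : 1 ≤ r′) where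

  open Cyclic (ε + (q + q))
  open DoublingMaps q ε tw
  open SquareClasses (ε + (q + q)) r′ 3+r′≡m
  open SquareCommon q ε ε≤1 tw r′ 3+r′≡m 1≤r′

  design : Framework.Design (ε + (q + q)) m (suc r′)
  design = record
    { latin = translationLatin (ε + (q + q))
    ; maps = symbolMaps
    ; plain = plain
    ; classP = two ; classQ = two ; classP≢0 = two≢0 ; classQ≢0 = two≢0
    ; whichB-classP = whichB-two ; whichB-classQ = whichB-two
    ; carriesP = λ _ → false ; carriesQ = λ _ → false
    ; carries-disjoint = λ _ _ ()
    ; linked = linked
    ; balanceP = λ _ → refl ; balanceQ = λ _ → refl
    ; uncarriedP = ∑-const-1 m ; uncarriedQ = ∑-const-1 m
    }
    where
    linked : ∀ a δ → δ ≢ Fin.zero → PlainClasses.whichB plain δ ≡ nothing →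
             ¬ (false ≡ true × δ ≡ two) → ¬ (false ≡ true × δ ≡ two) → a ⊞ e δ ≡ a ⊞ δ ⊞ e′ δ
    linked a δ δ≢0 w _ _ with unplain⇒two δ δ≢0 w
    ... | refl = trans (cong (a ⊞_) e-two) (sym (⊞-assoc a two (e′ two)))

  outline : HasOutlineArray (F-md m m (m + (2 + suc r′)))
  outline = kindOutline⇒outline (Framework.design⇒kindOutline _ _ _ design)

data Parity : ℕ → Set where
  odd-size : ∀ q → Parity (suc (q + q))
  even-size : ∀ q → Parity (suc (suc (q + q)))

parity : ∀ n → Parity (suc n)
parity zero = odd-size 0
parity (suc zero) = even-size 0
parity (suc (suc n)) with parity n
... | odd-size q = subst Parity (cong (suc ∘ suc) (+-suc q q)) (odd-size (suc q))
... | even-size q = subst Parity (cong (suc ∘ suc ∘ suc) (+-suc q q)) (even-size (suc q))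

cast-k : ∀ {m d k k′} → k ≡ k′ → HasOutlineArray (F-md m d k) → HasOutlineArray (F-md m d k′)
cast-k refl o = o

1+L<M : ∀ L r ε M → L + (2 + r) ≡ ε + M → ε ≤ r → suc L < M
1+L<M L r ε M L+2+r≡ ε≤r = +-cancelˡ-≤ ε (suc (suc L)) M (begin
  ε + suc (suc L)    ≡⟨ +-comm ε (suc (suc L)) ⟩
  suc (suc L) + ε    ≤⟨ +-monoʳ-≤ (suc (suc L)) ε≤r ⟩
  suc (suc L) + r    ≡⟨ trans (+-suc L (suc r)) (cong suc (+-suc L r)) ⟨
  L + (2 + r)        ≡⟨ L+2+r≡ ⟩
  ε + M              ∎)
  where open ≤-Reasoning

split-size : ∀ m r → 3 + r ≤ m → Σ ℕ λ L → 1 ≤ L × L + (2 + r) ≡ m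
split-size m r 3+r≤m = m ∸ (2 + r) , m<n⇒0<n∸m 3+r≤m , m∸n+n≡m (≤-trans (n≤1+n _) 3+r≤m)

outline-translation : ∀ q ε → ε ≤ 1 → Doubling.Twist q ε → ∀ d r → 3 + r ≤ suc (ε + (q + q)) → d ≤ suc (ε + (q + q)) →
                ε ≤ r ⊎ d ≡ 0 → HasOutlineArray (F-md (suc (ε + (q + q))) d (suc (ε + (q + q)) + (2 + r)))
outline-translation q ε ε≤1 tw d r 3+r≤m d≤m ε≤r⊎d≡0 with split-size (suc (ε + (q + q))) r 3+r≤m
... | L , 1≤L , L+2+r≡m =
  TranslationDesign.outline q ε ε≤1 tw L r d 1≤L L+2+r≡m d≤m
    (Sum.map₁ (1+L<M L r ε (suc (q + q)) (trans L+2+r≡m (sym (+-suc ε (q + q))))) ε≤r⊎d≡0)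

outline-absorbed : ∀ q d → 2 ≤ q → suc d ≤ suc (suc (q + q)) →
                 HasOutlineArray (F-md (suc (suc (q + q))) (suc d) (suc (suc (q + q)) + 2))
outline-absorbed q d 2≤q 1+d≤m with split-size (suc (q + q)) 1 4≤n
  where
  4≤n : 4 ≤ suc (q + q)
  4≤n = s≤s (≤-trans (n≤1+n 3) (+-mono-≤ 2≤q 2≤q))
... | L , 1≤L , L+3≡n = cast-k {suc (suc (q + q))} {suc d} (+-suc (suc (q + q)) 2)
  (Triangle.absorb-B (suc (q + q))
    (IsKindOutline-+ (Framework.design⇒kindOutline (q + q) d 1 design) (Triangle.triangle-outline (suc (q + q)))))
  where
  design : Framework.Design (q + q) d 1
  design = TranslationDesign.design q 0 z≤n (Doubling.twist-odd q) L 1 d 1≤L L+3≡n (s≤s⁻¹ 1+d≤m)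
                        (inj₁ (1+L<M L 1 0 (suc (q + q)) L+3≡n z≤n))

outline-even-tight : ∀ q d → 3 ≤ suc (suc (q + q)) → suc d ≤ suc (suc (q + q)) →
                   HasOutlineArray (F-md (suc (suc (q + q))) (suc d) (suc (suc (q + q)) + 2))
outline-even-tight 0 d (s≤s (s≤s ()))
outline-even-tight 1 d _ 1+d≤4 = outline₄ (suc d) (s≤s z≤n) 1+d≤4
outline-even-tight (suc (suc q)) d _ 1+d≤m = outline-absorbed (suc (suc q)) d (s≤s (s≤s z≤n)) 1+d≤m

outline-near-square : ∀ m d r → 3 + r ≤ m → d ≤ m → HasOutlineArray (F-md m d (m + (2 + r)))
outline-near-square (suc m₀) d r 3+r≤m d≤m with parity m₀
... | odd-size q = outline-translation q 0 z≤n (Doubling.twist-odd q) d r 3+r≤m d≤m (inj₁ z≤n)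
... | even-size q with r | d
...   | suc r′ | _ = outline-translation q 1 ≤-refl (Doubling.twist-even q) _ (suc r′) 3+r≤m d≤m (inj₁ (s≤s z≤n))
...   | zero | zero = outline-translation q 1 ≤-refl (Doubling.twist-even q) 0 0 3+r≤m d≤m (inj₂ refl)
...   | zero | suc d′ = outline-even-tight q d′ 3+r≤m d≤m

outline-square-for : ∀ q ε → ε ≤ 1 → Doubling.Twist q ε → ∀ d → 4 ≤ suc (ε + (q + q)) → d ≤ suc (ε + (q + q)) →
            suc (ε + (q + q)) ≤ 2 * d → HasOutlineArray (F-md (suc (ε + (q + q))) d (2 * suc (ε + (q + q))))
outline-square-for q ε ε≤1 tw d 4≤m d≤m m≤2d = cast-k {suc (ε + (q + q))} {d} k≡2m (by-deficit (m ∸ d) refl)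
  where
  m r′ : ℕ
  m = suc (ε + (q + q))
  r′ = m ∸ 3
  3+r′≡m : 3 + r′ ≡ m
  3+r′≡m = m+[n∸m]≡n (≤-trans (n≤1+n 3) 4≤m)
  1≤r′ : 1 ≤ r′
  1≤r′ = m<n⇒0<n∸m 4≤m
  k≡2m : m + (2 + suc r′) ≡ 2 * m
  k≡2m = cong (m +_) (trans 3+r′≡m (sym (+-identityʳ m)))
  d+[m∸d]≡m : d + (m ∸ d) ≡ m
  d+[m∸d]≡m = m+[n∸m]≡n d≤m
  by-deficit : ∀ h → m ∸ d ≡ h → HasOutlineArray (F-md m d (m + (2 + suc r′)))
  by-deficit zero m∸d≡0 = subst (λ x → HasOutlineArray (F-md m x (m + (2 + suc r′)))) m≡d
                                (SaturatedSquareDesign.outline q ε ε≤1 tw r′ 3+r′≡m 1≤r′)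
    where
    m≡d : m ≡ d
    m≡d = trans (sym d+[m∸d]≡m) (trans (cong (d +_) m∸d≡0) (+-identityʳ d))
  by-deficit (suc h′) m∸d≡h = SquareDesign.outline q ε ε≤1 tw r′ h′ d 3+r′≡m 1≤r′ 2h≤m d+h≡m
    where
    h : ℕ
    h = suc h′
    d+h≡m : d + h ≡ m
    d+h≡m = trans (cong (d +_) (sym m∸d≡h)) d+[m∸d]≡m
    2h≤m : h + h ≤ m
    2h≤m = +-cancelʳ-≤ (d + d) (h + h) m (begin
      h + h + (d + d)      ≡⟨ rearrange h d ⟩
      (d + h) + (d + h)    ≡⟨ cong₂ _+_ d+h≡m d+h≡m ⟩
      m + m                ≤⟨ +-monoʳ-≤ m (≤-trans m≤2d (≤-reflexive (cong (d +_) (+-identityʳ d)))) ⟩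
      m + (d + d)          ∎)
      where
      open ≤-Reasoning
      rearrange : ∀ h d → h + h + (d + d) ≡ (d + h) + (d + h)
      rearrange = solve-∀

outline-square : ∀ m d → 4 ≤ m → d ≤ m → m ≤ 2 * d → HasOutlineArray (F-md m d (2 * m))
outline-square (suc m₀) d 4≤m d≤m m≤2d with parity m₀
... | odd-size q = outline-square-for q 0 z≤n (Doubling.twist-odd q) d 4≤m d≤m m≤2d
... | even-size q = outline-square-for q 1 ≤-refl (Doubling.twist-even q) d 4≤m d≤m m≤2d

extra-symbols : ∀ m k → 1 ≤ m → m + 2 ≤ k → k ≤ 2 * m ∸ 1 → Σ ℕ λ r → k ≡ m + (2 + r) × 3 + r ≤ m
extra-symbols m k 1≤m m+2≤k k≤2m∸1 = r , k≡ , +-cancelˡ-≤ m (3 + r) m (begin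
  m + (3 + r)     ≡⟨ +-suc m (2 + r) ⟩
  suc (m + (2 + r)) ≡⟨ cong suc k≡ ⟨
  suc k           ≤⟨ ≤-trans (s≤s k≤2m∸1) (≤-reflexive (suc-pred (2 * m) {{>-nonZero 1≤2m}})) ⟩
  2 * m           ≡⟨ cong (m +_) (+-identityʳ m) ⟩
  m + m           ∎)
  where
  open ≤-Reasoning
  r : ℕ
  r = k ∸ (m + 2)
  k≡ : k ≡ m + (2 + r)
  k≡ = trans (sym (m+[n∸m]≡n m+2≤k)) (+-assoc m 2 r)
  1≤2m : 1 ≤ 2 * m
  1≤2m = ≤-trans 1≤m (m≤m+n m _)

mainTheorem20 : (m d : ℕ) → 3 ≤ m → d ≤ m →
    ((k : ℕ) → m + 2 ≤ k → k ≤ 2 * m ∸ 1 → HasOutlineArray (F-md m d k))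
    × (4 ≤ m → m ≤ 2 * d → HasOutlineArray (F-md m d (2 * m)))
mainTheorem20 m d 3≤m d≤m = near-square , (λ 4≤m m≤2d → outline-square m d 4≤m d≤m m≤2d)
  where
  near-square : (k : ℕ) → m + 2 ≤ k → k ≤ 2 * m ∸ 1 → HasOutlineArray (F-md m d k)
  near-square k m+2≤k k≤2m∸1 with extra-symbols m k (≤-trans (s≤s z≤n) 3≤m) m+2≤k k≤2m∸1
  ... | r , refl , 3+r≤m = outline-near-square m d r 3+r≤m d≤m
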